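{- Let $f\ge2$, $l$ an odd prime with $l=ef+1$, $K$ a field with $\operatorname{char}K\nmid f!$, $\operatorname{char}K\ne l$, $\operatorname{Gal}(K(\zeta_l)/K)\simeq(\mathbb{Z}/l\mathbb{Z})^\times=\langle\gamma\rangle$, $\beta=\gamma^e$, $L=K(\zeta_l)$. Let $V$, $h$, $W$ and $\overset{ -1}{\ast}$ be as in the context, and for ${\bf p}\in K^\times$ let $W_{\bf p}(K)=\{{\bf x}\in W(K)\mid h({\bf x})={\bf p}\}$. Then for all ${\bf p},{\bf q}\in K^\times$, the group law $\overset{ -1}{\ast}$ induces a well-defined map $W_{\bf p}(K)\times W_{\bf q}(K)\to W_{{\bf p}{\bf q}}(K)$, $({\bf x},{\bf y})\mapsto{\bf x}\overset{ -1}{\ast}{\bf y}$.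
   Context: For $t\in\mathbb{Z}/l\mathbb{Z}$ let $T_t({\bf x})=\sum x_{i_0}\cdots x_{i_{f-1}}$ over $(i_0,\dots,i_{f-1})\in(\mathbb{Z}/l\mathbb{Z})^f$ with $i_0+\beta i_1+\cdots+\beta^{f-1}i_{f-1}\equiv t\pmod l$, where ${\bf x}=(x_1,\dots,x_{l-1})$, $x_0=0$. $V\subset K^{l-1}$ is defined by $T_{\gamma^m}({\bf x})-T_{\gamma^{m+1}}({\bf x})=0$ ($m=1,\dots,e-1$); $h({\bf x})=T_0({\bf x})-T_\gamma({\bf x})$. For ${\bf x}\in V$, $\alpha_{\bf x}=(-1)^{f-1}\sum_{i=1}^{l-1}x_i\zeta_l^i$ and $W=\{{\bf x}\in V\mid N_{L/K}(\alpha_{\bf x})\ne0\}$. The operation is ${\bf x}\overset{ -1}{\ast}{\bf y}=(z_1,\dots,z_{l-1})$, $z_k=(-1)^{f-1}\big(\sum_{i=1}^{l-1}x_iy_{k-i}-\sum_{i=1}^{l-1}x_iy_{ -i}\big)$ (subscripts mod $l$, $x_0=y_0=0$); $W$ is a commutative algebraic $K$-group under it. -}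

module Defs where

open import Level using (Level; _⊔_) renaming (suc to lsuc)
open import Algebra.Bundles using (CommutativeRing)
open import Data.Bool using (if_then_else_)
open import Data.Nat as ℕ using (ℕ; zero; suc; _∸_; _<_; _≤_; _<?_; _≡ᵇ_)
open import Data.Nat.DivMod using (_%_)
open import Data.Fin using (Fin; toℕ; fromℕ<)
open import Data.List using (List; []; _∷_; map; concatMap; foldr; upTo; allFin)
open import Data.Product using (Σ; _×_; ∃)
open import Relation.Nullary using (¬_; yes; no)
open import Relation.Binary.PropositionalEquality using (_≡_)

record Field (c ℓ : Level) : Set (lsuc (c ⊔ ℓ)) where
  field
    commutativeRing : CommutativeRing c ℓ
  open CommutativeRing commutativeRing public
  field
    1≉0     : ¬ (1# ≈ 0#)
    inverse : ∀ x → ¬ (x ≈ 0#) → Σ Carrier (λ y → (x * y) ≈ 1#)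

-- Everything below lives over a field K, with l = e * f + 1.
-- Points of K^{l-1} are functions  Fin (e * f) → K ; the coordinate with
-- Fin-index i is x_{i+1}.

module Cyclotomic {c ℓ : Level} (K : Field c ℓ) (e f : ℕ) where
  open Field K

  n : ℕ
  n = e ℕ.* f

  l : ℕ
  l = suc n

  Pt : Set c
  Pt = Fin n → Carrier

  md : ℕ → ℕ
  md m = m % l

  ι : ℕ → Carrier
  ι zero    = 0#
  ι (suc k) = 1# + ι k

  sgn : ℕ → Carrier
  sgn zero    = 1#
  sgn (suc k) = - sgn k

  sumL : List Carrier → Carrier
  sumL = foldr _+_ 0#

  prodL : List Carrier → Carrier
  prodL = foldr _*_ 1#

  -- x_m for m read modulo l, with x_0 = 0
  ix : Pt → ℕ → Carrier
  ix x m = go (md m)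
    where
    go : ℕ → Carrier
    go zero = 0#
    go (suc k) with k <? n
    ... | yes k<n = x (fromℕ< k<n)
    ... | no _    = 0#

  Σ₁ : (ℕ → Carrier) → Carrier
  Σ₁ g = sumL (map (λ i → g (suc (toℕ i))) (allFin n))

  tuples : ℕ → List (List ℕ)
  tuples zero    = [] ∷ []
  tuples (suc k) = concatMap (λ i → map (i ∷_) (tuples k)) (upTo l)

  wt : ℕ → List ℕ → ℕ
  wt β []       = 0
  wt β (i ∷ is) = i ℕ.+ β ℕ.* wt β is

  T : ℕ → ℕ → Pt → Carrier
  T β t x = sumL (map term (tuples f))
    where
    term : List ℕ → Carrier
    term is = if md (wt β is) ≡ᵇ md t then prodL (map (ix x) is) else 0#

  module _ (γ : ℕ) where

    β : ℕ
    β = γ ℕ.^ e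

    InV : Pt → Set ℓ
    InV x = ∀ m → 1 ≤ m → m ≤ e ∸ 1 →
            T β (γ ℕ.^ m) x ≈ T β (γ ℕ.^ suc m) x

    h : Pt → Carrier
    h x = T β 0 x - T β γ x

  -- L = K(ζ_l) in coordinates w.r.t. the K-basis ζ, ζ^2, …, ζ^{l-1}
  -- (valid since Φ_l is irreducible over K, see the hypotheses).

  mulL : Pt → Pt → Pt
  mulL u v k = Σ₁ (λ i → ix u i * ix v (suc (toℕ k) ℕ.+ (l ∸ i)))
             - Σ₁ (λ i → ix u i * ix v (l ∸ i))

  -- 1 = −(ζ + ζ^2 + ⋯ + ζ^{l-1})
  oneL : Pt
  oneL k = - 1#

  -- the K-automorphism σ_a : ζ ↦ ζ^a of L
  σ : ℕ → Pt → Pt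
  σ a u k = Σ₁ (λ i → if md (a ℕ.* i) ≡ᵇ suc (toℕ k) then ix u i else 0#)

  normL : Pt → Pt
  normL u = foldr mulL oneL (map (λ a → σ (suc (toℕ a)) u) (allFin n))

  NonzeroL : Pt → Set ℓ
  NonzeroL u = ¬ (∀ k → u k ≈ 0#)

  α : Pt → Pt
  α x k = sgn (f ∸ 1) * x k

  InW : ℕ → Pt → Set ℓ
  InW γ x = InV γ x × NonzeroL (normL (α x))

  InWp : ℕ → Carrier → Pt → Set ℓ
  InWp γ p x = InW γ x × (h γ x ≈ p)

  op : Pt → Pt → Pt
  op x y k = sgn (f ∸ 1) * mulL x y k

  IsGenerator : ℕ → Set
  IsGenerator γ = ¬ (md γ ≡ 0) × (∀ k → 1 ≤ k → k < n → ¬ (md (γ ℕ.^ k) ≡ 1))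

  conv : (ℕ → Carrier) → (ℕ → Carrier) → ℕ → Carrier
  conv g h' k = sumL (map (λ i → g i * h' (k ∸ i)) (upTo (suc k)))

  CyclotomicReducible : Set (c ⊔ ℓ)
  CyclotomicReducible =
    Σ ℕ λ a → Σ ℕ λ b → Σ (ℕ → Carrier) λ g → Σ (ℕ → Carrier) λ h' →
      (1 ≤ a) × (1 ≤ b) × (a ℕ.+ b ≡ n) ×
      (∀ i → a < i → g i ≈ 0#) × (∀ j → b < j → h' j ≈ 0#) ×
      (∀ k → k ≤ n → conv g h' k ≈ 1#)

  -- [K(ζ_l) : K] = l − 1, i.e. Gal(K(ζ_l)/K) ≅ (ℤ/lℤ)^×
  CyclotomicIrreducible : Set (c ⊔ ℓ)
  CyclotomicIrreducible = ¬ CyclotomicReducible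

-- Write G = K[ℤ/lℤ] and 𝟙 = Σⱼ [j]. As 1 + ζ + ⋯ + ζ^(l−1) = 0, the coordinates x₁, …, x_(l−1)
-- identify K^(l−1) with G/(𝟙): mulL becomes convolution, σ_a is induced by j ↦ a j, the norm is
-- ∏_(a ≠ 0) σ_a, and T_t(x) is the t-th coefficient of P(x) = x · σ_β(x) ⋯ σ_(β^(f−1))(x) ∈ G.
-- Since β^f = 1, P(x) is σ_β-invariant, so its coefficients are constant on the cosets of ⟨β⟩ in
-- (ℤ/lℤ)^×; the equations of V identify these e cosets, so x ∈ V exactly when P(x) ≡ h(x)·[0]
-- modulo 𝟙. P is multiplicative, K·𝟙 is an ideal and ((−1)^(f−1))^f = 1, hence
-- P(x ∗ y) ≡ h(x) h(y)·[0], which gives x ∗ y ∈ V and h(x ∗ y) = pq. In the same way the norm of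
-- any element is invariant under every σ_a, hence ≡ c·[0] with c ≠ 0 iff the norm is nonzero, and
-- the constants multiply; as K has no zero divisors, N(α_(x ∗ y)) ≠ 0.

module Submission where

open import Defs
open import Level using (Level)
open import Data.Nat using (ℕ; _≤_; _!)
open import Data.Nat.Primality using (Prime)
open import Relation.Nullary using (¬_; yes; no)
open import Relation.Binary.PropositionalEquality using (_≢_)

open import Data.Nat as ℕ using (zero; suc; _<_; _∸_)
import Data.Nat.Properties as ℕₚ
open import Data.Nat.Primality using (prime⇒nonTrivial)
open import Data.Nat.Coprimality using (coprime-Bézout; prime⇒coprime)
open import Data.Nat.GCD using (module Bézout)
open import Data.Nat.DivMod using (_%_; %-distribˡ-+; %-distribˡ-*; m%n%n≡m%n; [m+kn]%n≡m%n; m%n<n; m<n⇒m%n≡m)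
open import Data.Nat.Tactic.RingSolver using (solve-∀)
open import Data.Fin as Fin using (Fin; toℕ; fromℕ<; punchOut)
import Data.Fin.Properties as Finₚ
open import Data.List as L using (List; []; _∷_)
open import Data.List.Properties using (map-tabulate; map-++; map-∘; map-applyUpTo)
open import Data.Product using (Σ; _×_; _,_; proj₁; proj₂; ∃)
open import Data.Empty using (⊥-elim)
open import Function using (_∘_)
open import Relation.Binary.Bundles using (Setoid)
open import Induction.WellFounded using (Acc; acc)
open import Data.Nat.Induction using (<-wellFounded)
open import Relation.Binary.PropositionalEquality as ≡ using (_≡_)
open import Algebra.Bundles using (Semiring; Ring; CommutativeRing; CommutativeMonoid)
import Algebra.Properties.CommutativeMonoid.Sum
open import Data.Bool using (true; false; if_then_else_)
open import Data.Bool.Properties using (T-≡; if-eta; if-float)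
open import Function.Bundles using (Equivalence)
open import Data.Fin.Permutation using (permutation)

module Residues (N : ℕ) where

  l : ℕ
  l = suc N

  infix 4 _≡ₗ_
  record _≡ₗ_ (a b : ℕ) : Set where
    constructor mk
    field get : a % l ≡ b % l
  open _≡ₗ_ public

  ≡ₗ-refl : ∀ {a} → a ≡ₗ a
  ≡ₗ-refl = mk ≡.refl

  ≡ₗ-sym : ∀ {a b} → a ≡ₗ b → b ≡ₗ a
  ≡ₗ-sym (mk p) = mk (≡.sym p)

  ≡ₗ-trans : ∀ {a b d} → a ≡ₗ b → b ≡ₗ d → a ≡ₗ d
  ≡ₗ-trans (mk p) (mk q) = mk (≡.trans p q)

  ≡⇒≡ₗ : ∀ {a b} → a ≡ b → a ≡ₗ b
  ≡⇒≡ₗ ≡.refl = ≡ₗ-refl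

  m%l≡ₗm : ∀ m → m % l ≡ₗ m
  m%l≡ₗm m = mk (m%n%n≡m%n m l)

  +-cong-≡ₗ : ∀ {a b d g} → a ≡ₗ b → d ≡ₗ g → a ℕ.+ d ≡ₗ b ℕ.+ g
  +-cong-≡ₗ {a} {b} {d} {g} (mk p) (mk q) = mk (≡.trans (%-distribˡ-+ a d l)
    (≡.trans (≡.cong₂ (λ x y → (x ℕ.+ y) % l) p q) (≡.sym (%-distribˡ-+ b g l))))

  *-cong-≡ₗ : ∀ {a b d g} → a ≡ₗ b → d ≡ₗ g → a ℕ.* d ≡ₗ b ℕ.* g
  *-cong-≡ₗ {a} {b} {d} {g} (mk p) (mk q) = mk (≡.trans (%-distribˡ-* a d l)
    (≡.trans (≡.cong₂ (λ x y → (x ℕ.* y) % l) p q) (≡.sym (%-distribˡ-* b g l))))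

  +-congˡ-≡ₗ : ∀ {a b} d → a ≡ₗ b → d ℕ.+ a ≡ₗ d ℕ.+ b
  +-congˡ-≡ₗ d = +-cong-≡ₗ (≡ₗ-refl {d})

  *-congˡ-≡ₗ : ∀ {a b} d → a ≡ₗ b → d ℕ.* a ≡ₗ d ℕ.* b
  *-congˡ-≡ₗ d = *-cong-≡ₗ (≡ₗ-refl {d})

  m+k*l≡ₗm : ∀ m k → m ℕ.+ k ℕ.* l ≡ₗ m
  m+k*l≡ₗm m k = mk ([m+kn]%n≡m%n m k l)

  m+x*l≡n+y*l⇒m≡ₗn : ∀ m n x y → m ℕ.+ x ℕ.* l ≡ n ℕ.+ y ℕ.* l → m ≡ₗ n
  m+x*l≡n+y*l⇒m≡ₗn m n x y eq =
    ≡ₗ-trans (≡ₗ-sym (m+k*l≡ₗm m x)) (≡ₗ-trans (≡⇒≡ₗ eq) (m+k*l≡ₗm n y))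

  residue : ℕ → Fin l
  residue m = fromℕ< (m%n<n m l)

  toℕ-residue : ∀ m → toℕ (residue m) ≡ m % l
  toℕ-residue m = Finₚ.toℕ-fromℕ< (m%n<n m l)

  toℕ-residue-≡ₗ : ∀ m → toℕ (residue m) ≡ₗ m
  toℕ-residue-≡ₗ m = ≡ₗ-trans (≡⇒≡ₗ (toℕ-residue m)) (m%l≡ₗm m)

  ≡ₗ⇒residue≡ : ∀ {a} {j : Fin l} → a ≡ₗ toℕ j → residue a ≡ j
  ≡ₗ⇒residue≡ {a} {j} (mk p) = Finₚ.toℕ-injective
    (≡.trans (toℕ-residue a) (≡.trans p (m<n⇒m%n≡m (Finₚ.toℕ<n j))))

  residue-cong : ∀ {a b} → a ≡ₗ b → residue a ≡ residue b
  residue-cong {a} {b} p = ≡ₗ⇒residue≡ (≡ₗ-trans p (≡ₗ-sym (toℕ-residue-≡ₗ b)))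

  residue-injective : ∀ {a b} → residue a ≡ residue b → a ≡ₗ b
  residue-injective {a} {b} eq =
    ≡ₗ-trans (≡ₗ-sym (toℕ-residue-≡ₗ a)) (≡ₗ-trans (≡⇒≡ₗ (≡.cong toℕ eq)) (toℕ-residue-≡ₗ b))

  residue-toℕ : ∀ (j : Fin l) → residue (toℕ j) ≡ j
  residue-toℕ j = ≡ₗ⇒residue≡ ≡ₗ-refl

  suc≢ₗ0 : ∀ (k : Fin N) → ¬ (suc (toℕ k) ≡ₗ 0)
  suc≢ₗ0 k eq with ≡.trans (≡.sym (m<n⇒m%n≡m (ℕ.s≤s (Finₚ.toℕ<n k)))) (get eq)
  ... | ()

  -- (a mod l) − 1, for a ≢ 0
  residue⁺ : ∀ a → ¬ (a ≡ₗ 0) → Fin N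
  residue⁺ a a≢0 = punchOut {i = Fin.zero} {j = residue a} (a≢0 ∘ residue-injective ∘ ≡.sym)

  suc-residue⁺ : ∀ a (a≢0 : ¬ (a ≡ₗ 0)) → Fin.suc (residue⁺ a a≢0) ≡ residue a
  suc-residue⁺ a a≢0 = Finₚ.punchIn-punchOut {i = Fin.zero} _

  toℕ-suc-residue⁺ : ∀ a (a≢0 : ¬ (a ≡ₗ 0)) → suc (toℕ (residue⁺ a a≢0)) ≡ₗ a
  toℕ-suc-residue⁺ a a≢0 = ≡ₗ-trans (≡⇒≡ₗ (≡.cong toℕ (suc-residue⁺ a a≢0))) (toℕ-residue-≡ₗ a)

  residue⁺-injective : ∀ {a b} (a≢0 : ¬ (a ≡ₗ 0)) (b≢0 : ¬ (b ≡ₗ 0)) →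
                       residue⁺ a a≢0 ≡ residue⁺ b b≢0 → a ≡ₗ b
  residue⁺-injective {a} {b} a≢0 b≢0 =
    residue-injective ∘ Finₚ.punchOut-injective {i = Fin.zero} {j = residue a} {k = residue b} _ _

  Unit : ℕ → Set
  Unit a = Σ ℕ λ b → a ℕ.* b ≡ₗ 1

  b*[a*r]≡ₗr : ∀ a b r → a ℕ.* b ≡ₗ 1 → b ℕ.* (a ℕ.* r) ≡ₗ r
  b*[a*r]≡ₗr a b r ab =
    ≡ₗ-trans (≡⇒≡ₗ (reassoc a b r)) (≡ₗ-trans (*-cong-≡ₗ ab (≡ₗ-refl {r})) (≡⇒≡ₗ (ℕₚ.+-identityʳ r)))
    where
    reassoc : ∀ a b r → b ℕ.* (a ℕ.* r) ≡ (a ℕ.* b) ℕ.* r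
    reassoc = solve-∀

  a*[b*r]≡ₗr : ∀ a b r → a ℕ.* b ≡ₗ 1 → a ℕ.* (b ℕ.* r) ≡ₗ r
  a*[b*r]≡ₗr a b r ab = b*[a*r]≡ₗr b a r (≡ₗ-trans (≡⇒≡ₗ (ℕₚ.*-comm b a)) ab)

  unit-cancelˡ : ∀ a → Unit a → ∀ {b d} → a ℕ.* b ≡ₗ a ℕ.* d → b ≡ₗ d
  unit-cancelˡ a (a′ , aa′) {b} {d} ab≡ad =
    ≡ₗ-trans (≡ₗ-sym (b*[a*r]≡ₗr a a′ b aa′)) (≡ₗ-trans (*-congˡ-≡ₗ a′ ab≡ad) (b*[a*r]≡ₗr a a′ d aa′))

  unit-* : ∀ a b → Unit a → Unit b → Unit (b ℕ.* a)
  unit-* a b (a′ , aa′) (b′ , bb′) = a′ ℕ.* b′ ,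
    ≡ₗ-trans (≡⇒≡ₗ (reassoc a b a′ b′)) (≡ₗ-trans (*-congˡ-≡ₗ b (*-cong-≡ₗ aa′ (≡ₗ-refl {b′})))
      (≡ₗ-trans (≡⇒≡ₗ (≡.cong (b ℕ.*_) (ℕₚ.*-identityˡ b′))) bb′))
    where
    reassoc : ∀ a b a′ b′ → (b ℕ.* a) ℕ.* (a′ ℕ.* b′) ≡ b ℕ.* ((a ℕ.* a′) ℕ.* b′)
    reassoc = solve-∀

  unit-^ : ∀ a → Unit a → ∀ k → Unit (a ℕ.^ k)
  unit-^ a U zero    = 1 , ≡ₗ-refl
  unit-^ a U (suc k) = unit-* (a ℕ.^ k) a (unit-^ a U k) U

  unit-inverse : ∀ a (U : Unit a) → Unit (proj₁ U)
  unit-inverse a (b , ab) = a , ≡ₗ-trans (≡⇒≡ₗ (ℕₚ.*-comm b a)) ab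

  unit⇒≢ₗ0 : 1 ≤ N → ∀ a → Unit a → ¬ (a ≡ₗ 0)
  unit⇒≢ₗ0 1≤N a (b , ab) a≡0 with 1≡0
    where
    1≡0 : 1 ≡ 0
    1≡0 = ≡.trans (≡.sym (m<n⇒m%n≡m (ℕ.s≤s 1≤N))) (get (≡ₗ-trans (≡ₗ-sym ab) (*-cong-≡ₗ a≡0 (≡ₗ-refl {b}))))
  ... | ()

  IsPrimitiveRoot : ℕ → Set
  IsPrimitiveRoot γ = ¬ (γ ≡ₗ 0) × (∀ k → 1 ≤ k → k < N → ¬ (γ ℕ.^ k ≡ₗ 1))

module PrimeResidues (N : ℕ) (l-prime : Prime (suc N)) where
  open Residues N

  1≤N : 1 ≤ N
  1≤N = ℕ.s≤s⁻¹ (ℕ.nonTrivial⇒n>1 (suc N) ⦃ prime⇒nonTrivial l-prime ⦄)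

  nonzero⇒unit : ∀ a → ¬ (a ≡ₗ 0) → Unit a
  nonzero⇒unit a a≢0
    with coprime-Bézout (prime⇒coprime l-prime ⦃ ℕ.≢-nonZero (a≢0 ∘ mk) ⦄ (m%n<n a l))
  ... | Bézout.+- x y eq = N ℕ.* y , ≡ₗ-trans (*-cong-≡ₗ (≡ₗ-sym (m%l≡ₗm a)) (≡ₗ-refl {N ℕ.* y}))
                             (m+x*l≡n+y*l⇒m≡ₗn _ 1 1 (N ℕ.* x)
                               (≡.trans (lhs N (a % l) y) (≡.trans (≡.cong (λ z → N ℕ.* z ℕ.+ 1) eq) (rhs N x))))
    where
    lhs : ∀ N a y → a ℕ.* (N ℕ.* y) ℕ.+ 1 ℕ.* suc N ≡ N ℕ.* (1 ℕ.+ y ℕ.* a) ℕ.+ 1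
    lhs = solve-∀
    rhs : ∀ N x → N ℕ.* (x ℕ.* suc N) ℕ.+ 1 ≡ 1 ℕ.+ (N ℕ.* x) ℕ.* suc N
    rhs = solve-∀
  ... | Bézout.-+ x y eq = y , ≡ₗ-trans (*-cong-≡ₗ (≡ₗ-sym (m%l≡ₗm a)) (≡ₗ-refl {y}))
                             (m+x*l≡n+y*l⇒m≡ₗn _ 1 0 x (≡.trans (lhs N (a % l) y) (≡.sym eq)))
    where
    lhs : ∀ N a y → a ℕ.* y ℕ.+ 0 ℕ.* suc N ≡ y ℕ.* a
    lhs = solve-∀

  nonzero-* : ∀ a b → ¬ (a ≡ₗ 0) → ¬ (b ≡ₗ 0) → ¬ (b ℕ.* a ≡ₗ 0)
  nonzero-* a b a≢0 b≢0 = unit⇒≢ₗ0 1≤N (b ℕ.* a) (unit-* a b (nonzero⇒unit a a≢0) (nonzero⇒unit b b≢0))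

  module PrimitiveRoot (γ : ℕ) (root : IsPrimitiveRoot γ) where

    γ^≢ₗ0 : ∀ i → ¬ (γ ℕ.^ i ≡ₗ 0)
    γ^≢ₗ0 i = unit⇒≢ₗ0 1≤N (γ ℕ.^ i) (unit-^ γ (nonzero⇒unit γ (proj₁ root)) i)

    γ^-position : ℕ → Fin N
    γ^-position i = residue⁺ (γ ℕ.^ i) (γ^≢ₗ0 i)

    γ^-position-injective : ∀ i j → γ^-position i ≡ γ^-position j → γ ℕ.^ i ≡ₗ γ ℕ.^ j
    γ^-position-injective i j = residue⁺-injective (γ^≢ₗ0 i) (γ^≢ₗ0 j)

    γ^[j∸i]≡ₗ1 : ∀ {i j} → i < j → γ ℕ.^ i ≡ₗ γ ℕ.^ j → γ ℕ.^ (j ∸ i) ≡ₗ 1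
    γ^[j∸i]≡ₗ1 {i} {j} i<j γ^i≡γ^j = unit-cancelˡ (γ ℕ.^ i) (unit-^ γ (nonzero⇒unit γ (proj₁ root)) i)
      (≡ₗ-trans (≡⇒≡ₗ γ^i*γ^[j∸i]≡γ^j) (≡ₗ-trans (≡ₗ-sym γ^i≡γ^j) (≡⇒≡ₗ (≡.sym (ℕₚ.*-identityʳ (γ ℕ.^ i))))))
      where
      γ^i*γ^[j∸i]≡γ^j : γ ℕ.^ i ℕ.* γ ℕ.^ (j ∸ i) ≡ γ ℕ.^ j
      γ^i*γ^[j∸i]≡γ^j = ≡.trans (≡.sym (ℕₚ.^-distribˡ-+-* γ i (j ∸ i))) (≡.cong (γ ℕ.^_) (ℕₚ.m+[n∸m]≡n (ℕₚ.<⇒≤ i<j)))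

    γ^d≡ₗ1⇒d≡N : ∀ d → 1 ≤ d → d ≤ N → γ ℕ.^ d ≡ₗ 1 → d ≡ N
    γ^d≡ₗ1⇒d≡N d 1≤d d≤N γ^d≡1 with d ℕ.<? N
    ... | yes d<N = ⊥-elim (proj₂ root d 1≤d d<N γ^d≡1)
    ... | no d≮N  = ℕₚ.≤-antisym d≤N (ℕₚ.≮⇒≥ d≮N)

    fermat : γ ℕ.^ N ≡ₗ 1
    fermat = from-collision (Finₚ.pigeonhole (ℕₚ.n<1+n N) (γ^-position ∘ toℕ))
      where
      from-collision : (∃ λ (i : Fin l) → ∃ λ j → toℕ i < toℕ j × γ^-position (toℕ i) ≡ γ^-position (toℕ j)) →
                       γ ℕ.^ N ≡ₗ 1
      from-collision (i , j , i<j , eq) = ≡.subst (λ d → γ ℕ.^ d ≡ₗ 1) d≡N γ^d≡1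
        where
        γ^d≡1 : γ ℕ.^ (toℕ j ∸ toℕ i) ≡ₗ 1
        γ^d≡1 = γ^[j∸i]≡ₗ1 i<j (γ^-position-injective (toℕ i) (toℕ j) eq)
        d≡N : toℕ j ∸ toℕ i ≡ N
        d≡N = γ^d≡ₗ1⇒d≡N _ (ℕₚ.m<n⇒0<n∸m i<j)
                (ℕₚ.≤-trans (ℕₚ.m∸n≤m (toℕ j) (toℕ i)) (ℕ.s≤s⁻¹ (Finₚ.toℕ<n j))) γ^d≡1

    nonzero⇒power : ∀ t → ¬ (t ≡ₗ 0) → ∃ λ j → γ ℕ.^ j ≡ₗ t
    nonzero⇒power t t≢0 = from-collision (Finₚ.pigeonhole (ℕₚ.n<1+n N) positions)
      where
      positions : Fin l → Fin N
      positions Fin.zero    = residue⁺ t t≢0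
      positions (Fin.suc j) = γ^-position (toℕ j)
      from-collision : (∃ λ (i : Fin l) → ∃ λ j → toℕ i < toℕ j × positions i ≡ positions j) →
                       ∃ λ j → γ ℕ.^ j ≡ₗ t
      from-collision (Fin.zero  , Fin.zero  , () , _)
      from-collision (Fin.suc _ , Fin.zero  , () , _)
      from-collision (Fin.zero  , Fin.suc j , _ , eq) = toℕ j , residue⁺-injective (γ^≢ₗ0 (toℕ j)) t≢0 (≡.sym eq)
      from-collision (Fin.suc i , Fin.suc j , ℕ.s≤s i<j , eq) =
        ⊥-elim (proj₂ root _ (ℕₚ.m<n⇒0<n∸m i<j) (ℕₚ.≤-<-trans (ℕₚ.m∸n≤m (toℕ j) (toℕ i)) (Finₚ.toℕ<n j))
          (γ^[j∸i]≡ₗ1 i<j (γ^-position-injective (toℕ i) (toℕ j) eq)))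

    module _ {a ℓ′} (S : Setoid a ℓ′) where
      open Setoid S

      module _ (e : ℕ) (1≤e : 1 ≤ e) (F : ℕ → Carrier)
               (F-cong : ∀ {s t} → s ≡ₗ t → F s ≈ F t)
               (F-γ^e : ∀ s → F (γ ℕ.^ e ℕ.* s) ≈ F s)
               (F-step : ∀ m → 1 ≤ m → m ≤ e ∸ 1 → F (γ ℕ.^ m) ≈ F (γ ℕ.^ suc m)) where

        constant-on-powers : ∀ j → Acc _<_ j → F (γ ℕ.^ suc j) ≈ F γ
        constant-on-powers zero    _        = F-cong (≡⇒≡ₗ (ℕₚ.*-identityʳ γ))
        constant-on-powers (suc j) (acc rs) with suc j ℕ.≤? e ∸ 1
        ... | yes 1+j≤e-1 = trans (sym (F-step (suc j) (ℕ.s≤s ℕ.z≤n) 1+j≤e-1)) (constant-on-powers j (rs ℕₚ.≤-refl))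
        ... | no  1+j≰e-1 = trans (F-cong (≡⇒≡ₗ γ^[2+j]≡γ^e*γ^[1+d])) (trans (F-γ^e (γ ℕ.^ suc d)) (constant-on-powers d (rs d<1+j)))
          where
          d : ℕ
          d = suc j ∸ e
          e+d≡1+j : e ℕ.+ d ≡ suc j
          e+d≡1+j = ℕₚ.m+[n∸m]≡n (≡.subst (_≤ suc j) (ℕₚ.suc-pred e ⦃ ℕ.>-nonZero 1≤e ⦄) (ℕₚ.≰⇒> 1+j≰e-1))
          γ^[2+j]≡γ^e*γ^[1+d] : γ ℕ.^ suc (suc j) ≡ γ ℕ.^ e ℕ.* γ ℕ.^ suc d
          γ^[2+j]≡γ^e*γ^[1+d] = ≡.trans (≡.cong (γ ℕ.^_) (≡.trans (≡.cong suc (≡.sym e+d≡1+j)) (≡.sym (ℕₚ.+-suc e d))))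
                                        (ℕₚ.^-distribˡ-+-* γ e (suc d))
          d<1+j : d < suc j
          d<1+j = ℕ.s≤s (ℕₚ.∸-monoʳ-≤ (suc j) 1≤e)

        constant-on-nonzero : ∀ t → ¬ (t ≡ₗ 0) → F t ≈ F γ
        constant-on-nonzero t t≢0 = from-power (nonzero⇒power t t≢0)
          where
          N≡1+[N-1] : N ≡ suc (N ∸ 1)
          N≡1+[N-1] = ≡.sym (ℕₚ.suc-pred N ⦃ ℕ.>-nonZero 1≤N ⦄)
          from-power : (∃ λ j → γ ℕ.^ j ≡ₗ t) → F t ≈ F γ
          from-power (suc j , γ^j≡t) = trans (F-cong (≡ₗ-sym γ^j≡t)) (constant-on-powers j (<-wellFounded j))
          from-power (zero  , 1≡t)   =
            trans (F-cong (≡ₗ-trans (≡ₗ-sym 1≡t) (≡ₗ-sym (≡.subst (λ k → γ ℕ.^ k ≡ₗ 1) N≡1+[N-1] fermat))))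
                  (constant-on-powers (N ∸ 1) (<-wellFounded (N ∸ 1)))

module GroupAlgebra {c ℓ : Level} (R : CommutativeRing c ℓ) (N : ℕ) where
  open CommutativeRing R
  open Residues N
  open import Algebra.Properties.Semiring.Sum semiring
  open import Algebra.Properties.AbelianGroup +-abelianGroup using (ε⁻¹≈ε; ⁻¹-∙-comm)
  open import Algebra.Properties.RingWithoutOne (Ring.ringWithoutOne ring) using (x[y-z]≈xy-xz)
  open import Algebra.Definitions.RawSemiring (Semiring.rawSemiring semiring) using (_^_)
  open import Relation.Binary.Reasoning.Setoid setoid
  open import Algebra.Properties.CommutativeSemigroup (CommutativeMonoid.commutativeSemigroup +-commutativeMonoid)
    using () renaming (interchange to +-interchange)
  open import Algebra.Properties.CommutativeSemigroup *-commutativeSemigroup using (x∙yz≈y∙xz)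

  x-0≈x : ∀ x → x - 0# ≈ x
  x-0≈x x = trans (+-congˡ ε⁻¹≈ε) (+-identityʳ x)

  [x+z]-[y+z]≈x-y : ∀ x y z → (x + z) - (y + z) ≈ x - y
  [x+z]-[y+z]≈x-y x y z = begin
    (x + z) + - (y + z)   ≈⟨ +-congˡ (sym (⁻¹-∙-comm y z)) ⟩
    (x + z) + (- y + - z) ≈⟨ +-interchange x z (- y) (- z) ⟩
    (x - y) + (z - z)     ≈⟨ +-congˡ (-‿inverseʳ z) ⟩
    (x - y) + 0#          ≈⟨ +-identityʳ _ ⟩
    x - y                 ∎

  [x-y]+y≈x : ∀ x y → (x - y) + y ≈ x
  [x-y]+y≈x x y = trans (+-assoc _ _ _) (trans (+-congˡ (-‿inverseˡ y)) (+-identityʳ x))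

  [x+y]-y≈x : ∀ x y → (x + y) - y ≈ x
  [x+y]-y≈x x y = trans (+-assoc _ _ _) (trans (+-congˡ (-‿inverseʳ y)) (+-identityʳ x))

  opaque
    ∑ : ∀ {k} → (Fin k → Carrier) → Carrier
    ∑ = sum

  opaque
    unfolding ∑

    ∑-cong : ∀ {k} {F G : Fin k → Carrier} → (∀ i → F i ≈ G i) → ∑ F ≈ ∑ G
    ∑-cong = sum-cong-≋

    ∑-suc : ∀ {k} (F : Fin (suc k) → Carrier) → ∑ F ≈ F Fin.zero + ∑ (F ∘ Fin.suc)
    ∑-suc F = refl

    ∑-zero : ∀ {k} (F : Fin k → Carrier) → (∀ i → F i ≈ 0#) → ∑ F ≈ 0#
    ∑-zero {k} F F≈0 = trans (sum-cong-≋ F≈0) (sum-replicate-zero k)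

    ∑-single : ∀ {k} (F : Fin k → Carrier) (i₀ : Fin k) → (∀ i → i ≢ i₀ → F i ≈ 0#) → ∑ F ≈ F i₀
    ∑-single {suc k} F i₀ F≈0 = begin
      sum F                                         ≈⟨ sum-remove {i = i₀} F ⟩
      F i₀ + sum (λ j → F (Fin.punchIn i₀ j))       ≈⟨ +-congˡ (∑-zero _ (λ j → F≈0 _ (Finₚ.punchInᵢ≢i i₀ j))) ⟩
      F i₀ + 0#                                     ≈⟨ +-identityʳ _ ⟩
      F i₀                                          ∎

    ∑-reindex : ∀ {k} (φ ψ : Fin k → Fin k) → (∀ y → φ (ψ y) ≡ y) → (∀ x → ψ (φ x) ≡ x) →
                (F : Fin k → Carrier) → ∑ F ≈ ∑ (F ∘ φ)
    ∑-reindex φ ψ φψ ψφ F = sum-permute F (permutation φ ψ φψ ψφ)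

    ∑-mulˡ : ∀ {k} x (F : Fin k → Carrier) → x * ∑ F ≈ ∑ (λ i → x * F i)
    ∑-mulˡ = *-distribˡ-sum

    ∑-mulʳ : ∀ {k} x (F : Fin k → Carrier) → ∑ F * x ≈ ∑ (λ i → F i * x)
    ∑-mulʳ = *-distribʳ-sum

    ∑-+ : ∀ {k} (F G : Fin k → Carrier) → ∑ (λ i → F i + G i) ≈ ∑ F + ∑ G
    ∑-+ = ∑-distrib-+

    ∑-swap : ∀ {k m} (F : Fin k → Fin m → Carrier) → ∑ (λ i → ∑ (λ j → F i j)) ≈ ∑ (λ j → ∑ (λ i → F i j))
    ∑-swap = ∑-comm

    foldr-tabulate : ∀ {k} (F : Fin k → Carrier) → L.foldr _+_ 0# (L.tabulate F) ≡ ∑ F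
    foldr-tabulate {zero}  F = ≡.refl
    foldr-tabulate {suc k} F = ≡.cong (F Fin.zero +_) (foldr-tabulate (F ∘ Fin.suc))

    foldr-applyUpTo : ∀ k (g : ℕ → Carrier) → L.foldr _+_ 0# (L.applyUpTo g k) ≡ ∑ (λ (i : Fin k) → g (toℕ i))
    foldr-applyUpTo zero    g = ≡.refl
    foldr-applyUpTo (suc k) g = ≡.cong (g 0 +_) (foldr-applyUpTo k (g ∘ suc))

  -- Σⱼ gⱼ [j] ∈ R[ℤ/lℤ] is represented by its coefficient function j ↦ gⱼ
  G : Set c
  G = Fin l → Carrier

  infix 4 _≈G_
  _≈G_ : G → G → Set ℓ
  u ≈G v = ∀ j → u j ≈ v j

  ≈G-refl : ∀ {u} → u ≈G u
  ≈G-refl j = refl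

  ≈G-sym : ∀ {u v} → u ≈G v → v ≈G u
  ≈G-sym p j = sym (p j)

  ≈G-trans : ∀ {u v w} → u ≈G v → v ≈G w → u ≈G w
  ≈G-trans p q j = trans (p j) (q j)

  at : G → ℕ → Carrier
  at g m = g (residue m)

  at-cong-≡ₗ : ∀ (g : G) {a b} → a ≡ₗ b → at g a ≡ at g b
  at-cong-≡ₗ g = ≡.cong g ∘ residue-cong

  at-toℕ : ∀ (g : G) j → at g (toℕ j) ≡ g j
  at-toℕ g j = ≡.cong g (residue-toℕ j)

  -- j − i modulo l, avoiding truncated subtraction
  infixl 6 _⊖_
  _⊖_ : Fin l → Fin l → ℕ
  j ⊖ i = toℕ j ℕ.+ N ℕ.* toℕ i

  infixl 7 _⋆_
  _⋆_ : G → G → G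
  (u ⋆ v) j = ∑ (λ i → u i * at v (j ⊖ i))

  infixl 6 _⊕_
  _⊕_ : G → G → G
  (u ⊕ v) j = u j + v j

  infixl 7 _⊙_
  _⊙_ : Carrier → G → G
  (a ⊙ u) j = a * u j

  δ₀ : G
  δ₀ Fin.zero    = 1#
  δ₀ (Fin.suc _) = 0#

  𝟙 : G
  𝟙 _ = 1#

  ⊕-cong : ∀ {u u′ v v′} → u ≈G u′ → v ≈G v′ → u ⊕ v ≈G u′ ⊕ v′
  ⊕-cong p q j = +-cong (p j) (q j)

  ⊙-cong : ∀ {a b u v} → a ≈ b → u ≈G v → a ⊙ u ≈G b ⊙ v
  ⊙-cong p q j = *-cong p (q j)

  ⊙-assoc : ∀ a b u → a ⊙ (b ⊙ u) ≈G (a * b) ⊙ u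
  ⊙-assoc a b u j = sym (*-assoc a b (u j))

  ⋆-cong : ∀ {u u′ v v′} → u ≈G u′ → v ≈G v′ → u ⋆ v ≈G u′ ⋆ v′
  ⋆-cong p q j = ∑-cong (λ i → *-cong (p i) (q _))

  ⋆-comm : ∀ u v → u ⋆ v ≈G v ⋆ u
  ⋆-comm u v j = begin
    ∑ (λ i → u i * at v (j ⊖ i))        ≈⟨ ∑-reindex φ φ φφ φφ _ ⟩
    ∑ (λ i → u (φ i) * at v (j ⊖ φ i))  ≈⟨ ∑-cong (λ i → *-cong refl (reflexive (≡.cong v (φφ i)))) ⟩
    ∑ (λ i → u (φ i) * v i)             ≈⟨ ∑-cong (λ i → *-comm _ _) ⟩
    ∑ (λ i → v i * at u (j ⊖ i))        ∎
    where
    φ : Fin l → Fin l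
    φ i = residue (j ⊖ i)
    j-[j-i]≡i : ∀ N j i → j ℕ.+ N ℕ.* (j ℕ.+ N ℕ.* i) ℕ.+ i ℕ.* suc N ≡ i ℕ.+ (j ℕ.+ i ℕ.* N) ℕ.* suc N
    j-[j-i]≡i = solve-∀
    φφ : ∀ i → φ (φ i) ≡ i
    φφ i = ≡ₗ⇒residue≡ (≡ₗ-trans (+-congˡ-≡ₗ (toℕ j) (*-congˡ-≡ₗ N (toℕ-residue-≡ₗ (j ⊖ i))))
                                  (m+x*l≡n+y*l⇒m≡ₗn _ _ (toℕ i) (toℕ j ℕ.+ toℕ i ℕ.* N) (j-[j-i]≡i N (toℕ j) (toℕ i))))

  ⋆-assoc : ∀ u v w → (u ⋆ v) ⋆ w ≈G u ⋆ (v ⋆ w)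
  ⋆-assoc u v w j = begin
    ∑ (λ k → ∑ (λ i → u i * at v (k ⊖ i)) * at w (j ⊖ k))    ≈⟨ ∑-cong (λ k → ∑-mulʳ _ _) ⟩
    ∑ (λ k → ∑ (λ i → (u i * at v (k ⊖ i)) * at w (j ⊖ k)))  ≈⟨ ∑-swap _ ⟩
    ∑ (λ i → ∑ (λ k → (u i * at v (k ⊖ i)) * at w (j ⊖ k)))  ≈⟨ ∑-cong (λ i → ∑-cong (λ k → *-assoc _ _ _)) ⟩
    ∑ (λ i → ∑ (λ k → u i * (at v (k ⊖ i) * at w (j ⊖ k))))  ≈⟨ ∑-cong (λ i → sym (∑-mulˡ _ _)) ⟩
    ∑ (λ i → u i * ∑ (λ k → at v (k ⊖ i) * at w (j ⊖ k)))    ≈⟨ ∑-cong (λ i → *-congˡ (shift i)) ⟩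
    ∑ (λ i → u i * at (v ⋆ w) (j ⊖ i))                       ∎
    where
    [k+i]-i≡k : ∀ N k i → k ℕ.+ i ℕ.+ N ℕ.* i ≡ k ℕ.+ i ℕ.* suc N
    [k+i]-i≡k = solve-∀
    [k-i]+i≡k : ∀ N k i → k ℕ.+ N ℕ.* i ℕ.+ i ≡ k ℕ.+ i ℕ.* suc N
    [k-i]+i≡k = solve-∀
    j-[k+i]≡[j-i]-k : ∀ N j k i → j ℕ.+ N ℕ.* (k ℕ.+ i) ≡ j ℕ.+ N ℕ.* i ℕ.+ N ℕ.* k
    j-[k+i]≡[j-i]-k = solve-∀
    shift : ∀ i → ∑ (λ k → at v (k ⊖ i) * at w (j ⊖ k)) ≈ at (v ⋆ w) (j ⊖ i)
    shift i = begin
      ∑ (λ k → at v (k ⊖ i) * at w (j ⊖ k))          ≈⟨ ∑-reindex φ ψ φψ ψφ _ ⟩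
      ∑ (λ k → at v (φ k ⊖ i) * at w (j ⊖ φ k))      ≈⟨ ∑-cong (λ k → *-cong (reflexive (v-eq k)) (reflexive (w-eq k))) ⟩
      ∑ (λ k → v k * at w (residue (j ⊖ i) ⊖ k))     ∎
      where
      φ ψ : Fin l → Fin l
      φ k = residue (toℕ k ℕ.+ toℕ i)
      ψ k = residue (k ⊖ i)
      φ-i : ∀ k → φ k ⊖ i ≡ₗ toℕ k
      φ-i k = ≡ₗ-trans (+-cong-≡ₗ (toℕ-residue-≡ₗ (toℕ k ℕ.+ toℕ i)) ≡ₗ-refl)
                (≡ₗ-trans (≡⇒≡ₗ ([k+i]-i≡k N (toℕ k) (toℕ i))) (m+k*l≡ₗm (toℕ k) (toℕ i)))
      φψ : ∀ y → φ (ψ y) ≡ y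
      φψ y = ≡ₗ⇒residue≡ (≡ₗ-trans (+-cong-≡ₗ (toℕ-residue-≡ₗ (y ⊖ i)) ≡ₗ-refl)
                (≡ₗ-trans (≡⇒≡ₗ ([k-i]+i≡k N (toℕ y) (toℕ i))) (m+k*l≡ₗm (toℕ y) (toℕ i))))
      ψφ : ∀ x → ψ (φ x) ≡ x
      ψφ x = ≡ₗ⇒residue≡ (φ-i x)
      v-eq : ∀ k → at v (φ k ⊖ i) ≡ v k
      v-eq k = ≡.trans (at-cong-≡ₗ v (φ-i k)) (at-toℕ v k)
      w-eq : ∀ k → at w (j ⊖ φ k) ≡ at w (residue (j ⊖ i) ⊖ k)
      w-eq k = at-cong-≡ₗ w (≡ₗ-trans (+-congˡ-≡ₗ (toℕ j) (*-congˡ-≡ₗ N (toℕ-residue-≡ₗ (toℕ k ℕ.+ toℕ i))))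
                 (≡ₗ-trans (≡⇒≡ₗ (j-[k+i]≡[j-i]-k N (toℕ j) (toℕ k) (toℕ i))) (≡ₗ-sym (+-cong-≡ₗ (toℕ-residue-≡ₗ (j ⊖ i)) ≡ₗ-refl))))

  ⋆-identityˡ : ∀ v → δ₀ ⋆ v ≈G v
  ⋆-identityˡ v j = begin
    ∑ (λ i → δ₀ i * at v (j ⊖ i))                                  ≈⟨ ∑-suc _ ⟩
    1# * at v (j ⊖ Fin.zero) + ∑ (λ i → 0# * at v (j ⊖ Fin.suc i)) ≈⟨ +-cong (*-identityˡ _) (∑-zero _ (λ i → zeroˡ _)) ⟩
    at v (j ⊖ Fin.zero) + 0#                                        ≈⟨ +-identityʳ _ ⟩
    at v (j ⊖ Fin.zero)                                             ≡⟨ ≡.trans (≡.cong (at v) j-0≡j) (at-toℕ v j) ⟩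
    v j                                                             ∎
    where
    j-0≡j : j ⊖ Fin.zero ≡ toℕ j
    j-0≡j = ≡.trans (≡.cong (toℕ j ℕ.+_) (ℕₚ.*-zeroʳ N)) (ℕₚ.+-identityʳ (toℕ j))

  ⋆-identityʳ : ∀ v → v ⋆ δ₀ ≈G v
  ⋆-identityʳ v = ≈G-trans (⋆-comm v δ₀) (⋆-identityˡ v)

  ⋆-distribˡ : ∀ u v w → u ⋆ (v ⊕ w) ≈G u ⋆ v ⊕ u ⋆ w
  ⋆-distribˡ u v w j = trans (∑-cong (λ i → distribˡ _ _ _)) (∑-+ _ _)

  ⋆-distribʳ : ∀ u v w → (u ⊕ v) ⋆ w ≈G u ⋆ w ⊕ v ⋆ w
  ⋆-distribʳ u v w = ≈G-trans (⋆-comm _ _) (≈G-trans (⋆-distribˡ w u v) (⊕-cong (⋆-comm w u) (⋆-comm w v)))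

  ⋆-⊙ʳ : ∀ u a v → u ⋆ (a ⊙ v) ≈G a ⊙ (u ⋆ v)
  ⋆-⊙ʳ u a v j = trans (∑-cong (λ i → x∙yz≈y∙xz (u i) a (at v (j ⊖ i)))) (sym (∑-mulˡ _ _))

  ⋆-⊙ˡ : ∀ a u v → (a ⊙ u) ⋆ v ≈G a ⊙ (u ⋆ v)
  ⋆-⊙ˡ a u v = ≈G-trans (⋆-comm _ _) (≈G-trans (⋆-⊙ʳ v a u) (⊙-cong refl (⋆-comm v u)))

  ⋆-𝟙 : ∀ u → u ⋆ 𝟙 ≈G ∑ u ⊙ 𝟙
  ⋆-𝟙 u j = trans (∑-cong (λ i → *-identityʳ _)) (sym (*-identityʳ _))

  ⊙δ₀-⋆-⊙δ₀ : ∀ x y → (x ⊙ δ₀) ⋆ (y ⊙ δ₀) ≈G (x * y) ⊙ δ₀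
  ⊙δ₀-⋆-⊙δ₀ x y = ≈G-trans (⋆-⊙ˡ x δ₀ (y ⊙ δ₀)) (≈G-trans (⊙-cong refl (⋆-identityˡ (y ⊙ δ₀))) (⊙-assoc x y δ₀))

  ⋆-commutativeMonoid : CommutativeMonoid c ℓ
  ⋆-commutativeMonoid = record
    { Carrier = G
    ; _≈_ = _≈G_
    ; _∙_ = _⋆_
    ; ε = δ₀
    ; isCommutativeMonoid = record
      { isMonoid = record
        { isSemigroup = record
          { isMagma = record
            { isEquivalence = record { refl = λ {u} → ≈G-refl {u} ; sym = ≈G-sym ; trans = ≈G-trans }
            ; ∙-cong = ⋆-cong }
          ; assoc = ⋆-assoc }
        ; identity = ⋆-identityˡ , ⋆-identityʳ }
      ; comm = ⋆-comm }
    }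

  infix 4 _∼_
  _∼_ : G → G → Set (c Level.⊔ ℓ)
  u ∼ v = Σ Carrier λ a → u ≈G v ⊕ a ⊙ 𝟙

  ≈G⇒∼ : ∀ {u v} → u ≈G v → u ∼ v
  ≈G⇒∼ p = 0# , λ j → trans (p j) (sym (trans (+-congˡ (zeroˡ _)) (+-identityʳ _)))

  ∼-trans : ∀ {u v w} → u ∼ v → v ∼ w → u ∼ w
  ∼-trans (a , p) (b , q) = b + a , λ j → trans (p j) (trans (+-congʳ (q j))
    (trans (+-assoc _ _ _) (+-congˡ (sym (distribʳ _ _ _)))))

  ∼-⊙ : ∀ {a b u} → a ≈ b → u ∼ a ⊙ δ₀ → u ∼ b ⊙ δ₀
  ∼-⊙ a≈b u∼aδ₀ = ∼-trans u∼aδ₀ (≈G⇒∼ (⊙-cong a≈b ≈G-refl))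

  ∼⊙δ₀-at-zero : ∀ {A x} (p : A ∼ x ⊙ δ₀) → A Fin.zero ≈ x + proj₁ p
  ∼⊙δ₀-at-zero {x = x} (d , p) = trans (p Fin.zero) (+-cong (*-identityʳ x) (*-identityʳ d))

  ∼⊙δ₀-at-nonzero : ∀ {A x} (p : A ∼ x ⊙ δ₀) → ∀ t → ¬ (t ≡ₗ 0) → at A t ≈ proj₁ p
  ∼⊙δ₀-at-nonzero {A} {x} (d , p) t t≢0 with residue t in eq
  ... | Fin.zero  = ⊥-elim (t≢0 (residue-injective eq))
  ... | Fin.suc k = trans (p (Fin.suc k)) (trans (+-cong (zeroʳ x) (*-identityʳ d)) (+-identityˡ d))

  ∼-⋆ˡ : ∀ {u u′} w → u ∼ u′ → u ⋆ w ∼ u′ ⋆ w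
  ∼-⋆ˡ {u} {u′} w (a , p) = a * ∑ w , λ j → begin
    (u ⋆ w) j                          ≈⟨ ⋆-cong p (≈G-refl {w}) j ⟩
    ((u′ ⊕ a ⊙ 𝟙) ⋆ w) j               ≈⟨ ⋆-distribʳ u′ (a ⊙ 𝟙) w j ⟩
    (u′ ⋆ w) j + ((a ⊙ 𝟙) ⋆ w) j       ≈⟨ +-congˡ (⋆-⊙ˡ a 𝟙 w j) ⟩
    (u′ ⋆ w) j + a * (𝟙 ⋆ w) j         ≈⟨ +-congˡ (*-congˡ (trans (⋆-comm 𝟙 w j) (⋆-𝟙 w j))) ⟩
    (u′ ⋆ w) j + a * (∑ w * 1#)        ≈⟨ +-congˡ (sym (*-assoc _ _ _)) ⟩
    (u′ ⋆ w) j + (a * ∑ w) * 1#        ∎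

  ∼-⋆ : ∀ {u u′ v v′} → u ∼ u′ → v ∼ v′ → u ⋆ v ∼ u′ ⋆ v′
  ∼-⋆ {u} {u′} {v} {v′} p q =
    ∼-trans (∼-⋆ˡ v p) (∼-trans (≈G⇒∼ (⋆-comm u′ v)) (∼-trans (∼-⋆ˡ u′ q) (≈G⇒∼ (⋆-comm v′ u′))))

  constant⇒∼⊙δ₀ : ∀ A a → (∀ (k : Fin N) → A (Fin.suc k) ≈ a) → A ∼ (A Fin.zero - a) ⊙ δ₀
  constant⇒∼⊙δ₀ A a A≈a = a , coefficient
    where
    coefficient : ∀ j → A j ≈ ((A Fin.zero - a) ⊙ δ₀ ⊕ a ⊙ 𝟙) j
    coefficient Fin.zero    = sym (trans (+-cong (*-identityʳ _) (*-identityʳ a)) ([x-y]+y≈x _ a))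
    coefficient (Fin.suc k) = trans (A≈a k) (sym (trans (+-cong (zeroʳ _) (*-identityʳ a)) (+-identityˡ a)))

  -- coordinates in R[ℤ/lℤ]/(𝟙) w.r.t. the images of [1], …, [l − 1]; [0] ≡ −([1] + ⋯ + [l − 1])
  π : G → (Fin N → Carrier)
  π g k = g (Fin.suc k) - g Fin.zero

  emb : (Fin N → Carrier) → G
  emb u Fin.zero    = 0#
  emb u (Fin.suc k) = u k

  emb-cong : ∀ {u v : Fin N → Carrier} → (∀ k → u k ≈ v k) → emb u ≈G emb v
  emb-cong p Fin.zero    = refl
  emb-cong p (Fin.suc k) = p k

  π-cong : ∀ {u v} → u ≈G v → ∀ k → π u k ≈ π v k
  π-cong p k = +-cong (p _) (-‿cong (p _))

  π-∼ : ∀ {u v} → u ∼ v → ∀ k → π u k ≈ π v k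
  π-∼ (a , p) k = trans (π-cong p k) ([x+z]-[y+z]≈x-y _ _ _)

  π-∼⊙δ₀ : ∀ {A x} → A ∼ x ⊙ δ₀ → ∀ k → π A k ≈ - x
  π-∼⊙δ₀ {x = x} p k = trans (π-∼ p k) (trans (+-cong (zeroʳ x) (-‿cong (*-identityʳ x))) (+-identityˡ _))

  emb∘π∼id : ∀ g → emb (π g) ∼ g
  emb∘π∼id g = - g Fin.zero , coefficient
    where
    coefficient : ∀ j → emb (π g) j ≈ g j + - g Fin.zero * 1#
    coefficient Fin.zero    = sym (trans (+-congˡ (*-identityʳ _)) (-‿inverseʳ _))
    coefficient (Fin.suc k) = sym (+-congˡ (*-identityʳ _))

  π-⊙ : ∀ a g k → π (a ⊙ g) k ≈ a * π g k
  π-⊙ a g k = sym (x[y-z]≈xy-xz a _ _)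

  -- the endomorphism of R[ℤ/lℤ] induced by j ↦ a j (an automorphism when a is a unit)
  σ̂ : ℕ → G → G
  σ̂ a g j = ∑ (λ r → if (a ℕ.* toℕ r) % l ℕ.≡ᵇ toℕ j then g r else 0#)

  σ̂-at : ∀ a b g → a ℕ.* b ≡ₗ 1 → ∀ j → σ̂ a g j ≈ at g (b ℕ.* toℕ j)
  σ̂-at a b g ab j = trans (∑-single _ r₀ others) (reflexive (≡.cong (if_then g r₀ else 0#) hit))
    where
    r₀ : Fin l
    r₀ = residue (b ℕ.* toℕ j)
    hit : ((a ℕ.* toℕ r₀) % l ℕ.≡ᵇ toℕ j) ≡ true
    hit = Equivalence.to T-≡ (ℕₚ.≡⇒≡ᵇ _ _ (≡.trans (get (≡ₗ-trans (*-congˡ-≡ₗ a (toℕ-residue-≡ₗ (b ℕ.* toℕ j))) (a*[b*r]≡ₗr a b (toℕ j) ab)))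
                                                     (m<n⇒m%n≡m (Finₚ.toℕ<n j))))
    others : ∀ r → r ≢ r₀ → (if (a ℕ.* toℕ r) % l ℕ.≡ᵇ toℕ j then g r else 0#) ≈ 0#
    others r r≢r₀ with (a ℕ.* toℕ r) % l ℕ.≡ᵇ toℕ j in eq
    ... | false = refl
    ... | true  = ⊥-elim (r≢r₀ (≡.sym (≡ₗ⇒residue≡ (≡ₗ-trans (≡ₗ-sym (*-congˡ-≡ₗ b ar≡j)) (b*[a*r]≡ₗr a b (toℕ r) ab)))))
      where
      ar≡j : a ℕ.* toℕ r ≡ₗ toℕ j
      ar≡j = mk (≡.trans (ℕₚ.≡ᵇ⇒≡ _ _ (Equivalence.from T-≡ eq)) (≡.sym (m<n⇒m%n≡m (Finₚ.toℕ<n j))))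

  σ̂-cong : ∀ a {u v} → u ≈G v → σ̂ a u ≈G σ̂ a v
  σ̂-cong a p j = ∑-cong (λ r → if-≈ ((a ℕ.* toℕ r) % l ℕ.≡ᵇ toℕ j) (p r))
    where
    if-≈ : ∀ B {x y} → x ≈ y → (if B then x else 0#) ≈ (if B then y else 0#)
    if-≈ true  p = p
    if-≈ false p = refl

  σ̂-cong-≡ₗ : ∀ {a a′} g → a ≡ₗ a′ → σ̂ a g ≈G σ̂ a′ g
  σ̂-cong-≡ₗ g a≡a′ j = ∑-cong (λ r → reflexive (≡.cong (λ w → if w ℕ.≡ᵇ toℕ j then g r else 0#)
                                                           (get (*-cong-≡ₗ a≡a′ (≡ₗ-refl {toℕ r})))))

  σ̂-⊕ : ∀ a → Unit a → ∀ u v → σ̂ a (u ⊕ v) ≈G σ̂ a u ⊕ σ̂ a v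
  σ̂-⊕ a (b , ab) u v j = trans (σ̂-at a b (u ⊕ v) ab j) (sym (+-cong (σ̂-at a b u ab j) (σ̂-at a b v ab j)))

  σ̂-⊙ : ∀ a → Unit a → ∀ x u → σ̂ a (x ⊙ u) ≈G x ⊙ σ̂ a u
  σ̂-⊙ a (b , ab) x u j = trans (σ̂-at a b (x ⊙ u) ab j) (sym (*-congˡ (σ̂-at a b u ab j)))

  σ̂-𝟙 : ∀ a → Unit a → σ̂ a 𝟙 ≈G 𝟙
  σ̂-𝟙 a (b , ab) = σ̂-at a b 𝟙 ab

  σ̂-∼ : ∀ a → Unit a → ∀ {u v} → u ∼ v → σ̂ a u ∼ σ̂ a v
  σ̂-∼ a U {u} {v} (x , p) = x , λ j →
    trans (σ̂-cong a p j) (trans (σ̂-⊕ a U v (x ⊙ 𝟙) j) (+-congˡ (trans (σ̂-⊙ a U x 𝟙 j) (*-congˡ (σ̂-𝟙 a U j)))))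

  σ̂-δ₀ : ∀ a → Unit a → σ̂ a δ₀ ≈G δ₀
  σ̂-δ₀ a (b , ab) j = trans (σ̂-at a b δ₀ ab j) (coefficient j)
    where
    coefficient : ∀ j → at δ₀ (b ℕ.* toℕ j) ≈ δ₀ j
    coefficient Fin.zero    = reflexive (≡.cong (at δ₀) (ℕₚ.*-zeroʳ b))
    coefficient (Fin.suc k) with residue (b ℕ.* suc (toℕ k)) in eq
    ... | Fin.suc _ = refl
    ... | Fin.zero  = ⊥-elim (suc≢ₗ0 k (≡ₗ-trans (≡ₗ-sym (a*[b*r]≡ₗr a b (suc (toℕ k)) ab))
                        (≡ₗ-trans (*-congˡ-≡ₗ a (residue-injective {_} {0} eq)) (≡⇒≡ₗ (ℕₚ.*-zeroʳ a)))))

  σ̂-⋆ : ∀ a → Unit a → ∀ u v → σ̂ a (u ⋆ v) ≈G σ̂ a u ⋆ σ̂ a v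
  σ̂-⋆ a (b , ab) u v j = begin
    σ̂ a (u ⋆ v) j                                       ≈⟨ σ̂-at a b (u ⋆ v) ab j ⟩
    ∑ (λ i → u i * at v (residue (b ℕ.* toℕ j) ⊖ i))     ≈⟨ ∑-reindex φ ψ φψ ψφ _ ⟩
    ∑ (λ i → u (φ i) * at v (residue (b ℕ.* toℕ j) ⊖ φ i)) ≈⟨ ∑-cong (λ i → *-cong (sym (σ̂-at a b u ab i)) (reflexive (v-eq i))) ⟩
    ∑ (λ i → σ̂ a u i * at v (b ℕ.* toℕ (residue (j ⊖ i)))) ≈⟨ ∑-cong (λ i → *-congˡ (sym (σ̂-at a b v ab (residue (j ⊖ i))))) ⟩
    ∑ (λ i → σ̂ a u i * at (σ̂ a v) (j ⊖ i))               ∎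
    where
    φ ψ : Fin l → Fin l
    φ i = residue (b ℕ.* toℕ i)
    ψ i = residue (a ℕ.* toℕ i)
    φψ : ∀ y → φ (ψ y) ≡ y
    φψ y = ≡ₗ⇒residue≡ (≡ₗ-trans (*-congˡ-≡ₗ b (toℕ-residue-≡ₗ (a ℕ.* toℕ y))) (b*[a*r]≡ₗr a b (toℕ y) ab))
    ψφ : ∀ x → ψ (φ x) ≡ x
    ψφ x = ≡ₗ⇒residue≡ (≡ₗ-trans (*-congˡ-≡ₗ a (toℕ-residue-≡ₗ (b ℕ.* toℕ x))) (a*[b*r]≡ₗr a b (toℕ x) ab))
    *-distrib-⊖ : ∀ b j N i → b ℕ.* j ℕ.+ N ℕ.* (b ℕ.* i) ≡ b ℕ.* (j ℕ.+ N ℕ.* i)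
    *-distrib-⊖ = solve-∀
    v-eq : ∀ i → at v (residue (b ℕ.* toℕ j) ⊖ φ i) ≡ at v (b ℕ.* toℕ (residue (j ⊖ i)))
    v-eq i = at-cong-≡ₗ v (≡ₗ-trans (+-cong-≡ₗ (toℕ-residue-≡ₗ (b ℕ.* toℕ j)) (*-congˡ-≡ₗ N (toℕ-residue-≡ₗ (b ℕ.* toℕ i))))
               (≡ₗ-trans (≡⇒≡ₗ (*-distrib-⊖ b (toℕ j) N (toℕ i))) (≡ₗ-sym (*-congˡ-≡ₗ b (toℕ-residue-≡ₗ (j ⊖ i))))))

  σ̂-∘ : ∀ a b → Unit a → Unit b → ∀ g → σ̂ b (σ̂ a g) ≈G σ̂ (b ℕ.* a) g
  σ̂-∘ a b Ua@(a′ , aa′) Ub@(b′ , bb′) g j = begin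
    σ̂ b (σ̂ a g) j                                   ≈⟨ σ̂-at b b′ (σ̂ a g) bb′ j ⟩
    σ̂ a g (residue (b′ ℕ.* toℕ j))                  ≈⟨ σ̂-at a a′ g aa′ _ ⟩
    at g (a′ ℕ.* toℕ (residue (b′ ℕ.* toℕ j)))      ≡⟨ at-cong-≡ₗ g (≡ₗ-trans (*-congˡ-≡ₗ a′ (toℕ-residue-≡ₗ (b′ ℕ.* toℕ j)))
                                                                       (≡⇒≡ₗ (≡.sym (ℕₚ.*-assoc a′ b′ (toℕ j))))) ⟩
    at g ((a′ ℕ.* b′) ℕ.* toℕ j)                    ≈⟨ sym (σ̂-at (b ℕ.* a) (a′ ℕ.* b′) g (proj₂ (unit-* a b Ua Ub)) j) ⟩
    σ̂ (b ℕ.* a) g j                                 ∎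

  σ̂-1 : ∀ g → σ̂ 1 g ≈G g
  σ̂-1 g j = trans (σ̂-at 1 1 g ≡ₗ-refl j) (reflexive (≡.trans (≡.cong (at g) (ℕₚ.*-identityˡ (toℕ j))) (at-toℕ g j)))

  σ̂-invariant⇒at-≈ : ∀ a → Unit a → ∀ A → σ̂ a A ≈G A → ∀ s → at A (a ℕ.* s) ≈ at A s
  σ̂-invariant⇒at-≈ a (b , ab) A inv s = begin
    at A (a ℕ.* s)                                ≈⟨ inv (residue (a ℕ.* s)) ⟨
    σ̂ a A (residue (a ℕ.* s))                     ≈⟨ σ̂-at a b A ab (residue (a ℕ.* s)) ⟩
    at A (b ℕ.* toℕ (residue (a ℕ.* s)))          ≡⟨ at-cong-≡ₗ A (≡ₗ-trans (*-congˡ-≡ₗ b (toℕ-residue-≡ₗ (a ℕ.* s))) (b*[a*r]≡ₗr a b s ab)) ⟩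
    at A s                                        ∎

  open import Algebra.Properties.CommutativeSemigroup (CommutativeMonoid.commutativeSemigroup ⋆-commutativeMonoid)
    using () renaming (interchange to ⋆-interchange)
  module ⋆-Sum = Algebra.Properties.CommutativeMonoid.Sum ⋆-commutativeMonoid

  opaque
    ∏ : ∀ {k} → (Fin k → G) → G
    ∏ = ⋆-Sum.sum

  opaque
    unfolding ∏

    ∏-cong : ∀ {k} {F H : Fin k → G} → (∀ a → F a ≈G H a) → ∏ F ≈G ∏ H
    ∏-cong = ⋆-Sum.sum-cong-≋

    ∏-⋆ : ∀ {k} (F H : Fin k → G) → ∏ (λ a → F a ⋆ H a) ≈G ∏ F ⋆ ∏ H
    ∏-⋆ = ⋆-Sum.∑-distrib-+

    ∏-reindex : ∀ {k} (φ ψ : Fin k → Fin k) → (∀ y → φ (ψ y) ≡ y) → (∀ x → ψ (φ x) ≡ x) →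
                (F : Fin k → G) → ∏ F ≈G ∏ (F ∘ φ)
    ∏-reindex φ ψ φψ ψφ F = ⋆-Sum.sum-permute F (permutation φ ψ φψ ψφ)

    ∏-zero : (H : Fin 0 → G) → ∏ H ≈G δ₀
    ∏-zero H = ≈G-refl

    ∏-suc : ∀ {k} (H : Fin (suc k) → G) → ∏ H ≈G H Fin.zero ⋆ ∏ (H ∘ Fin.suc)
    ∏-suc H = ≈G-refl

  σ̂-∏ : ∀ b → Unit b → ∀ {k} (H : Fin k → G) → σ̂ b (∏ H) ≈G ∏ (λ a → σ̂ b (H a))
  σ̂-∏ b U {zero}  H = ≈G-trans (σ̂-cong b (∏-zero H)) (≈G-trans (σ̂-δ₀ b U) (≈G-sym (∏-zero _)))
  σ̂-∏ b U {suc k} H =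
    ≈G-trans (σ̂-cong b (∏-suc H)) (≈G-trans (σ̂-⋆ b U (H Fin.zero) (∏ (H ∘ Fin.suc)))
      (≈G-trans (⋆-cong (≈G-refl {σ̂ b (H Fin.zero)}) (σ̂-∏ b U (H ∘ Fin.suc))) (≈G-sym (∏-suc _))))

  orbitProd : ℕ → ℕ → G → G
  orbitProd B zero    u = δ₀
  orbitProd B (suc k) u = u ⋆ σ̂ B (orbitProd B k u)

  module _ (B : ℕ) (UB : Unit B) where

    orbitProd-⋆ : ∀ k u v → orbitProd B k (u ⋆ v) ≈G orbitProd B k u ⋆ orbitProd B k v
    orbitProd-⋆ zero    u v = ≈G-sym (⋆-identityˡ δ₀)
    orbitProd-⋆ (suc k) u v =
      ≈G-trans (⋆-cong (≈G-refl {u ⋆ v}) (≈G-trans (σ̂-cong B (orbitProd-⋆ k u v)) (σ̂-⋆ B UB (orbitProd B k u) (orbitProd B k v))))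
               (⋆-interchange u v (σ̂ B (orbitProd B k u)) (σ̂ B (orbitProd B k v)))

    orbitProd-∼ : ∀ k {u v} → u ∼ v → orbitProd B k u ∼ orbitProd B k v
    orbitProd-∼ zero    p = ≈G⇒∼ ≈G-refl
    orbitProd-∼ (suc k) p = ∼-⋆ p (σ̂-∼ B UB (orbitProd-∼ k p))

    orbitProd-⊙ : ∀ k a u → orbitProd B k (a ⊙ u) ≈G (a ^ k) ⊙ orbitProd B k u
    orbitProd-⊙ zero    a u j = sym (*-identityˡ _)
    orbitProd-⊙ (suc k) a u =
      ≈G-trans (⋆-cong (≈G-refl {a ⊙ u}) (≈G-trans (σ̂-cong B (orbitProd-⊙ k a u)) (σ̂-⊙ B UB (a ^ k) (orbitProd B k u))))
      (≈G-trans (⋆-⊙ˡ a u (a ^ k ⊙ σ̂ B (orbitProd B k u)))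
      (≈G-trans (⊙-cong refl (⋆-⊙ʳ u (a ^ k) (σ̂ B (orbitProd B k u)))) (⊙-assoc a (a ^ k) (u ⋆ σ̂ B (orbitProd B k u)))))

    orbitProd-sucʳ : ∀ k u → orbitProd B (suc k) u ≈G orbitProd B k u ⋆ σ̂ (B ℕ.^ k) u
    orbitProd-sucʳ zero u =
      ≈G-trans (⋆-cong (≈G-refl {u}) (σ̂-δ₀ B UB))
        (≈G-trans (⋆-identityʳ u) (≈G-trans (≈G-sym (σ̂-1 u)) (≈G-sym (⋆-identityˡ (σ̂ 1 u)))))
    orbitProd-sucʳ (suc k) u =
      ≈G-trans (⋆-cong (≈G-refl {u}) (≈G-trans (σ̂-cong B (orbitProd-sucʳ k u))
                 (≈G-trans (σ̂-⋆ B UB (orbitProd B k u) (σ̂ (B ℕ.^ k) u))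
                   (⋆-cong (≈G-refl {σ̂ B (orbitProd B k u)}) (σ̂-∘ (B ℕ.^ k) B (unit-^ B UB k) UB u)))))
        (≈G-sym (⋆-assoc u (σ̂ B (orbitProd B k u)) (σ̂ (B ℕ.^ suc k) u)))

    orbitProd-invariant : ∀ k → B ℕ.^ k ≡ₗ 1 → ∀ u → σ̂ B (orbitProd B k u) ≈G orbitProd B k u
    orbitProd-invariant zero    _    u = σ̂-δ₀ B UB
    orbitProd-invariant (suc k) B^k≡1 u =
      ≈G-trans (σ̂-cong B (orbitProd-sucʳ k u))
      (≈G-trans (σ̂-⋆ B UB (orbitProd B k u) (σ̂ (B ℕ.^ k) u))
      (≈G-trans (⋆-cong (≈G-refl {σ̂ B (orbitProd B k u)})
                  (≈G-trans (σ̂-∘ (B ℕ.^ k) B (unit-^ B UB k) UB u) (≈G-trans (σ̂-cong-≡ₗ u B^k≡1) (σ̂-1 u))))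
      (⋆-comm (σ̂ B (orbitProd B k u)) u)))

  module Norm (l-prime : Prime l) where
    open PrimeResidues N l-prime

    unit⁺ : ∀ (a : Fin N) → Unit (suc (toℕ a))
    unit⁺ a = nonzero⇒unit _ (suc≢ₗ0 a)

    norm : G → G
    norm g = ∏ (λ (a : Fin N) → σ̂ (suc (toℕ a)) g)

    norm-⋆ : ∀ g h → norm (g ⋆ h) ≈G norm g ⋆ norm h
    norm-⋆ g h = ≈G-trans (∏-cong (λ a → σ̂-⋆ (suc (toℕ a)) (unit⁺ a) g h)) (∏-⋆ _ _)

    -- multiplication by a nonzero m, as a map on the nonzero residues 1, …, l − 1
    scale : ∀ m → ¬ (m ≡ₗ 0) → Fin N → Fin N
    scale m m≢0 a = residue⁺ (m ℕ.* suc (toℕ a)) (nonzero-* (suc (toℕ a)) m (suc≢ₗ0 a) m≢0)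

    suc-scale : ∀ m (m≢0 : ¬ (m ≡ₗ 0)) a → Fin.suc (scale m m≢0 a) ≡ residue (m ℕ.* suc (toℕ a))
    suc-scale m m≢0 a = suc-residue⁺ (m ℕ.* suc (toℕ a)) (nonzero-* (suc (toℕ a)) m (suc≢ₗ0 a) m≢0)

    toℕ-suc-scale : ∀ m (m≢0 : ¬ (m ≡ₗ 0)) a → suc (toℕ (scale m m≢0 a)) ≡ₗ m ℕ.* suc (toℕ a)
    toℕ-suc-scale m m≢0 a = toℕ-suc-residue⁺ (m ℕ.* suc (toℕ a)) (nonzero-* (suc (toℕ a)) m (suc≢ₗ0 a) m≢0)

    scale-inverse : ∀ m m′ (m≢0 : ¬ (m ≡ₗ 0)) (m′≢0 : ¬ (m′ ≡ₗ 0)) → m ℕ.* m′ ≡ₗ 1 →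
                    ∀ a → scale m′ m′≢0 (scale m m≢0 a) ≡ a
    scale-inverse m m′ m≢0 m′≢0 mm′ a = Finₚ.suc-injective (≡.trans (suc-scale m′ m′≢0 (scale m m≢0 a))
      (≡ₗ⇒residue≡ (≡ₗ-trans (*-congˡ-≡ₗ m′ (toℕ-suc-scale m m≢0 a)) (b*[a*r]≡ₗr m m′ (suc (toℕ a)) mm′))))

    norm-invariant : ∀ (t : Fin N) g → σ̂ (suc (toℕ t)) (norm g) ≈G norm g
    norm-invariant t g =
      ≈G-trans (σ̂-∏ b (unit⁺ t) (λ a → σ̂ (suc (toℕ a)) g))
      (≈G-trans (∏-cong {F = λ a → σ̂ b (σ̂ (suc (toℕ a)) g)} {H = λ a → σ̂ (suc (toℕ (scale b b≢0 a))) g} rotate)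
                (≈G-sym (∏-reindex (scale b b≢0) (scale b′ b′≢0)
                                   (scale-inverse b′ b b′≢0 b≢0 (proj₂ (unit-inverse b U)))
                                   (scale-inverse b b′ b≢0 b′≢0 (proj₂ U))
                                   (λ a → σ̂ (suc (toℕ a)) g))))
      where
      b : ℕ
      b = suc (toℕ t)
      U : Unit b
      U = unit⁺ t
      b′ : ℕ
      b′ = proj₁ U
      b≢0 : ¬ (b ≡ₗ 0)
      b≢0 = suc≢ₗ0 t
      b′≢0 : ¬ (b′ ≡ₗ 0)
      b′≢0 = unit⇒≢ₗ0 1≤N b′ (unit-inverse b U)
      rotate : ∀ a → σ̂ b (σ̂ (suc (toℕ a)) g) ≈G σ̂ (suc (toℕ (scale b b≢0 a))) g
      rotate a = ≈G-trans (σ̂-∘ (suc (toℕ a)) b (unit⁺ a) U g)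
                          (σ̂-cong-≡ₗ {b ℕ.* suc (toℕ a)} {suc (toℕ (scale b b≢0 a))} g
                                     (≡ₗ-sym (toℕ-suc-scale b b≢0 a)))

    normCoeff : G → Carrier
    normCoeff g = norm g Fin.zero - at (norm g) 1

    norm-decomposed : ∀ g → norm g ∼ normCoeff g ⊙ δ₀
    norm-decomposed g = constant⇒∼⊙δ₀ (norm g) (at (norm g) 1) constant
      where
      constant : ∀ (t : Fin N) → norm g (Fin.suc t) ≈ at (norm g) 1
      constant t = begin
        norm g (Fin.suc t)                 ≡⟨ at-toℕ (norm g) (Fin.suc t) ⟨
        at (norm g) (suc (toℕ t))          ≡⟨ at-cong-≡ₗ (norm g) (≡⇒≡ₗ (ℕₚ.*-identityʳ (suc (toℕ t)))) ⟨
        at (norm g) (suc (toℕ t) ℕ.* 1)    ≈⟨ σ̂-invariant⇒at-≈ (suc (toℕ t)) (unit⁺ t) (norm g) (norm-invariant t g) 1 ⟩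
        at (norm g) 1                      ∎

module Coordinates {c ℓ : Level} (K : Field c ℓ) (e f : ℕ) where
  open Field K
  open Cyclotomic K e f hiding (l)
  open Residues n
  open GroupAlgebra commutativeRing n
  open import Algebra.Properties.AbelianGroup +-abelianGroup using (⁻¹-involutive; ε⁻¹≈ε)
  open import Algebra.Properties.RingWithoutOne (Ring.ringWithoutOne ring) using (-‿distribˡ-*)
  open import Algebra.Definitions.RawSemiring (Semiring.rawSemiring semiring) using (_^_)
  open import Relation.Binary.Reasoning.Setoid setoid

  infix 4 _≈P_
  _≈P_ : Pt → Pt → Set ℓ
  u ≈P v = ∀ k → u k ≈ v k

  ix-cong-≡ₗ : ∀ (u : Pt) {a b} → a ≡ₗ b → ix u a ≡ ix u b
  ix-cong-≡ₗ u {a} {b} (mk eq) with a % l | b % l | eq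
  ... | _ | _ | ≡.refl = ≡.refl

  ix-suc : ∀ (u : Pt) (k : Fin n) → ix u (suc (toℕ k)) ≡ u k
  ix-suc u k with suc (toℕ k) % l | m<n⇒m%n≡m (ℕ.s≤s (Finₚ.toℕ<n k))
  ... | _ | ≡.refl with toℕ k ℕ.<? n
  ...   | yes k<n = ≡.cong u (Finₚ.fromℕ<-toℕ k k<n)
  ...   | no  k≮n = ⊥-elim (k≮n (Finₚ.toℕ<n k))

  ix≡at-emb : ∀ (u : Pt) m → ix u m ≡ at (emb u) m
  ix≡at-emb u m = ≡.trans (ix-cong-≡ₗ u (≡ₗ-sym (toℕ-residue-≡ₗ m))) (ix-toℕ (residue m))
    where
    ix-toℕ : ∀ j → ix u (toℕ j) ≡ emb u j
    ix-toℕ Fin.zero    = ≡.refl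
    ix-toℕ (Fin.suc k) = ix-suc u k

  Σ₁≡∑ : ∀ (g : ℕ → Carrier) → Σ₁ g ≡ ∑ (λ (i : Fin n) → g (suc (toℕ i)))
  Σ₁≡∑ g = ≡.trans (≡.cong sumL (map-tabulate {n = n} (λ i → i) (λ i → g (suc (toℕ i))))) (foldr-tabulate _)

  -- mulL writes the index k − i as k + (l − i), which agrees with _⊖_ modulo l for 1 ≤ i ≤ l − 1
  mulL-term≈⋆ : ∀ (u v : Pt) (j : Fin l) → Σ₁ (λ i → ix u i * ix v (toℕ j ℕ.+ (l ∸ i))) ≈ (emb u ⋆ emb v) j
  mulL-term≈⋆ u v j = begin
    Σ₁ (λ i → ix u i * ix v (toℕ j ℕ.+ (l ∸ i)))
      ≡⟨ Σ₁≡∑ (λ i → ix u i * ix v (toℕ j ℕ.+ (l ∸ i))) ⟩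
    ∑ (λ i → ix u (suc (toℕ i)) * ix v (toℕ j ℕ.+ (n ∸ toℕ i)))
      ≈⟨ ∑-cong (λ i → *-cong (reflexive (ix-suc u i)) (reflexive (v-eq i))) ⟩
    ∑ (λ i → emb u (Fin.suc i) * at (emb v) (j ⊖ Fin.suc i))
      ≈⟨ +-identityˡ _ ⟨
    0# + ∑ (λ i → emb u (Fin.suc i) * at (emb v) (j ⊖ Fin.suc i))
      ≈⟨ +-congʳ (zeroˡ (at (emb v) (j ⊖ Fin.zero))) ⟨
    emb u Fin.zero * at (emb v) (j ⊖ Fin.zero) + ∑ (λ i → emb u (Fin.suc i) * at (emb v) (j ⊖ Fin.suc i))
      ≈⟨ ∑-suc _ ⟨
    (emb u ⋆ emb v) j
      ∎
    where
    [d+i]*[1+i]≡d+i*[1+d+i] : ∀ d i → (d ℕ.+ i) ℕ.* suc i ≡ d ℕ.+ i ℕ.* suc (d ℕ.+ i)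
    [d+i]*[1+i]≡d+i*[1+d+i] = solve-∀
    n*[1+i]≡ₗn-i : ∀ (i : Fin n) → n ℕ.* suc (toℕ i) ≡ₗ n ∸ toℕ i
    n*[1+i]≡ₗn-i i = ≡ₗ-trans (≡⇒≡ₗ (≡.subst (λ m → m ℕ.* suc (toℕ i) ≡ (n ∸ toℕ i) ℕ.+ toℕ i ℕ.* suc m)
                                              (ℕₚ.m∸n+n≡m (ℕₚ.<⇒≤ (Finₚ.toℕ<n i))) ([d+i]*[1+i]≡d+i*[1+d+i] (n ∸ toℕ i) (toℕ i))))
                               (m+k*l≡ₗm (n ∸ toℕ i) (toℕ i))
    v-eq : ∀ (i : Fin n) → ix v (toℕ j ℕ.+ (n ∸ toℕ i)) ≡ at (emb v) (j ⊖ Fin.suc i)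
    v-eq i = ≡.trans (ix≡at-emb v (toℕ j ℕ.+ (n ∸ toℕ i))) (at-cong-≡ₗ (emb v) (+-congˡ-≡ₗ (toℕ j) (≡ₗ-sym (n*[1+i]≡ₗn-i i))))

  mulL≈π⋆ : ∀ u v → mulL u v ≈P π (emb u ⋆ emb v)
  mulL≈π⋆ u v k = +-cong (mulL-term≈⋆ u v (Fin.suc k)) (-‿cong (mulL-term≈⋆ u v Fin.zero))

  mulL-cong : ∀ {u u′ v v′} → u ≈P u′ → v ≈P v′ → mulL u v ≈P mulL u′ v′
  mulL-cong {u} {u′} {v} {v′} p q k =
    trans (mulL≈π⋆ u v k) (trans (π-cong (⋆-cong (emb-cong p) (emb-cong q)) k) (sym (mulL≈π⋆ u′ v′ k)))

  mulL-π : ∀ g h → mulL (π g) (π h) ≈P π (g ⋆ h)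
  mulL-π g h k = trans (mulL≈π⋆ (π g) (π h) k) (π-∼ (∼-⋆ (emb∘π∼id g) (emb∘π∼id h)) k)

  σ≈σ̂-emb : ∀ a (u : Pt) k → σ a u k ≈ σ̂ a (emb u) (Fin.suc k)
  σ≈σ̂-emb a u k = begin
    σ a u k
      ≡⟨ Σ₁≡∑ (λ i → if md (a ℕ.* i) ℕ.≡ᵇ suc (toℕ k) then ix u i else 0#) ⟩
    ∑ (λ i → if md (a ℕ.* suc (toℕ i)) ℕ.≡ᵇ suc (toℕ k) then ix u (suc (toℕ i)) else 0#)
      ≈⟨ ∑-cong (λ i → reflexive (≡.cong (if md (a ℕ.* suc (toℕ i)) ℕ.≡ᵇ suc (toℕ k) then_else 0#) (ix-suc u i))) ⟩
    ∑ (λ i → if md (a ℕ.* suc (toℕ i)) ℕ.≡ᵇ suc (toℕ k) then emb u (Fin.suc i) else 0#)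
      ≈⟨ +-identityˡ _ ⟨
    0# + ∑ (λ i → if md (a ℕ.* suc (toℕ i)) ℕ.≡ᵇ suc (toℕ k) then emb u (Fin.suc i) else 0#)
      ≡⟨ ≡.cong (_+ ∑ (λ i → if md (a ℕ.* suc (toℕ i)) ℕ.≡ᵇ suc (toℕ k) then emb u (Fin.suc i) else 0#))
                (if-eta (md (a ℕ.* 0) ℕ.≡ᵇ suc (toℕ k))) ⟨
    (if md (a ℕ.* 0) ℕ.≡ᵇ suc (toℕ k) then 0# else 0#)
      + ∑ (λ i → if md (a ℕ.* suc (toℕ i)) ℕ.≡ᵇ suc (toℕ k) then emb u (Fin.suc i) else 0#)
      ≈⟨ ∑-suc _ ⟨
    σ̂ a (emb u) (Fin.suc k)
      ∎

  σ-cong : ∀ a {u v} → u ≈P v → σ a u ≈P σ a v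
  σ-cong a {u} {v} p k = trans (σ≈σ̂-emb a u k) (trans (σ̂-cong a (emb-cong p) (Fin.suc k)) (sym (σ≈σ̂-emb a v k)))

  σ-π : ∀ a → Unit a → ∀ g → σ a (π g) ≈P π (σ̂ a g)
  σ-π a U@(b , ab) g k = begin
    σ a (π g) k                                        ≈⟨ σ≈σ̂-emb a (π g) k ⟩
    σ̂ a (emb (π g)) (Fin.suc k)                        ≈⟨ x-0≈x _ ⟨
    σ̂ a (emb (π g)) (Fin.suc k) - 0#                   ≈⟨ +-congˡ (-‿cong σ̂-emb-at-zero) ⟨
    π (σ̂ a (emb (π g))) k                              ≈⟨ π-∼ (σ̂-∼ a U (emb∘π∼id g)) k ⟩
    π (σ̂ a g) k                                        ∎
    where
    σ̂-emb-at-zero : σ̂ a (emb (π g)) Fin.zero ≈ 0#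
    σ̂-emb-at-zero = trans (σ̂-at a b (emb (π g)) ab Fin.zero) (reflexive (≡.cong (at (emb (π g))) (ℕₚ.*-zeroʳ b)))

  foldr-mulL≈π∏ : ∀ {k} (H : Fin k → Pt) (H′ : Fin k → G) → (∀ a → H a ≈P π (H′ a)) →
                  L.foldr mulL oneL (L.tabulate H) ≈P π (∏ H′)
  foldr-mulL≈π∏ {zero}  H H′ p k = sym (trans (π-cong (∏-zero H′) k) (+-identityˡ _))
  foldr-mulL≈π∏ {suc _} H H′ p k =
    trans (mulL-cong (p Fin.zero) (foldr-mulL≈π∏ (H ∘ Fin.suc) (H′ ∘ Fin.suc) (p ∘ Fin.suc)) k)
          (trans (mulL-π (H′ Fin.zero) (∏ (H′ ∘ Fin.suc)) k) (π-cong (≈G-sym (∏-suc H′)) k))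

  sumL-++ : ∀ (xs ys : List Carrier) → sumL (xs L.++ ys) ≈ sumL xs + sumL ys
  sumL-++ []       ys = sym (+-identityˡ _)
  sumL-++ (x ∷ xs) ys = trans (+-congˡ (sumL-++ xs ys)) (sym (+-assoc _ _ _))

  sumL-cong : ∀ {A : Set} {g g′ : A → Carrier} (xs : List A) → (∀ a → g a ≈ g′ a) → sumL (L.map g xs) ≈ sumL (L.map g′ xs)
  sumL-cong []       p = refl
  sumL-cong (x ∷ xs) p = +-cong (p x) (sumL-cong xs p)

  sumL-zero : ∀ {A : Set} (g : A → Carrier) (xs : List A) → (∀ a → g a ≈ 0#) → sumL (L.map g xs) ≈ 0#
  sumL-zero g []       p = refl
  sumL-zero g (x ∷ xs) p = trans (+-cong (p x) (sumL-zero g xs p)) (+-identityˡ 0#)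

  sumL-concatMap : ∀ {A : Set} (g : A → Carrier) (gs : ℕ → List A) (xs : List ℕ) →
                   sumL (L.map g (L.concatMap gs xs)) ≈ sumL (L.map (λ i → sumL (L.map g (gs i))) xs)
  sumL-concatMap g gs []       = refl
  sumL-concatMap g gs (i ∷ xs) = begin
    sumL (L.map g (gs i L.++ L.concatMap gs xs))              ≡⟨ ≡.cong sumL (map-++ g (gs i) (L.concatMap gs xs)) ⟩
    sumL (L.map g (gs i) L.++ L.map g (L.concatMap gs xs))    ≈⟨ sumL-++ (L.map g (gs i)) _ ⟩
    sumL (L.map g (gs i)) + sumL (L.map g (L.concatMap gs xs)) ≈⟨ +-congˡ (sumL-concatMap g gs xs) ⟩
    sumL (L.map (λ i → sumL (L.map g (gs i))) (i ∷ xs))       ∎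

  sumL-*ˡ : ∀ {A : Set} a (g : A → Carrier) (xs : List A) → a * sumL (L.map g xs) ≈ sumL (L.map (λ z → a * g z) xs)
  sumL-*ˡ a g []       = zeroʳ a
  sumL-*ˡ a g (x ∷ xs) = trans (distribˡ _ _ _) (+-congˡ (sumL-*ˡ a g xs))

  ∑-sumL : ∀ {A : Set} {k} (H : Fin k → A → Carrier) (xs : List A) →
           ∑ (λ r → sumL (L.map (H r) xs)) ≈ sumL (L.map (λ z → ∑ (λ r → H r z)) xs)
  ∑-sumL H []       = ∑-zero _ (λ r → refl)
  ∑-sumL H (x ∷ xs) = trans (∑-+ _ _) (+-congˡ (∑-sumL H xs))

  if-sumL : ∀ {A : Set} B (g : A → Carrier) (xs : List A) →
            (if B then sumL (L.map g xs) else 0#) ≈ sumL (L.map (λ z → if B then g z else 0#) xs)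
  if-sumL true  g xs = refl
  if-sumL false g xs = sym (sumL-zero _ xs (λ _ → refl))

  ≡ᵇ-true : ∀ {a b} → a ≡ b → (a ℕ.≡ᵇ b) ≡ true
  ≡ᵇ-true {a} {b} = Equivalence.to T-≡ ∘ ℕₚ.≡⇒≡ᵇ a b

  ≡ᵇ-true⁻¹ : ∀ {a b} → (a ℕ.≡ᵇ b) ≡ true → a ≡ b
  ≡ᵇ-true⁻¹ {a} {b} = ℕₚ.≡ᵇ⇒≡ a b ∘ Equivalence.from T-≡

  ≡ᵇ-cong-⇔ : ∀ {a b a′ b′} → (a ≡ b → a′ ≡ b′) → (a′ ≡ b′ → a ≡ b) → (a ℕ.≡ᵇ b) ≡ (a′ ℕ.≡ᵇ b′)
  ≡ᵇ-cong-⇔ {a} {b} {a′} {b′} to from with a ℕ.≡ᵇ b in eq | a′ ℕ.≡ᵇ b′ in eq′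
  ... | true  | true  = ≡.refl
  ... | false | false = ≡.refl
  ... | true  | false with () ← ≡.trans (≡.sym (≡ᵇ-true (to (≡ᵇ-true⁻¹ eq)))) eq′
  ... | false | true  with () ← ≡.trans (≡.sym (≡ᵇ-true (from (≡ᵇ-true⁻¹ eq′)))) eq

  Tₖ : ℕ → ℕ → ℕ → Pt → Carrier
  Tₖ k B t x = sumL (L.map (λ is → if md (wt B is) ℕ.≡ᵇ md t then prodL (L.map (ix x) is) else 0#) (tuples k))

  Tₖ-cong-≡ₗ : ∀ k B {t t′} x → t ≡ₗ t′ → Tₖ k B t x ≡ Tₖ k B t′ x
  Tₖ-cong-≡ₗ k B x (mk eq) =
    ≡.cong (λ w → sumL (L.map (λ is → if md (wt B is) ℕ.≡ᵇ w then prodL (L.map (ix x) is) else 0#) (tuples k))) eq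

  Tᴳ : ℕ → ℕ → Pt → G
  Tᴳ k B x j = Tₖ k B (toℕ j) x

  Tᴳ-zero : ∀ B x → Tᴳ 0 B x ≈G δ₀
  Tᴳ-zero B x Fin.zero    = +-identityʳ 1#
  Tᴳ-zero B x (Fin.suc j) =
    trans (+-identityʳ _) (reflexive (≡.cong (λ w → if 0 ℕ.≡ᵇ w then 1# else 0#) (m<n⇒m%n≡m (ℕ.s≤s (Finₚ.toℕ<n j)))))

  σ̂-Tᴳ : ∀ k B x (j : Fin l) → σ̂ B (Tᴳ k B x) j ≈
         sumL (L.map (λ is → if md (B ℕ.* toℕ (residue (wt B is))) ℕ.≡ᵇ toℕ j then prodL (L.map (ix x) is) else 0#) (tuples k))
  σ̂-Tᴳ k B x j = begin
    ∑ (λ r → if md (B ℕ.* toℕ r) ℕ.≡ᵇ toℕ j then Tₖ k B (toℕ r) x else 0#)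
      ≈⟨ ∑-cong (λ r → if-sumL (md (B ℕ.* toℕ r) ℕ.≡ᵇ toℕ j) _ (tuples k)) ⟩
    ∑ (λ r → sumL (L.map (term r) (tuples k)))
      ≈⟨ ∑-sumL term (tuples k) ⟩
    sumL (L.map (λ is → ∑ (λ r → term r is)) (tuples k))
      ≈⟨ sumL-cong (tuples k) single ⟩
    _ ∎
    where
    term : Fin l → List ℕ → Carrier
    term r is = if md (B ℕ.* toℕ r) ℕ.≡ᵇ toℕ j then (if md (wt B is) ℕ.≡ᵇ md (toℕ r) then prodL (L.map (ix x) is) else 0#) else 0#
    single : ∀ is → ∑ (λ r → term r is) ≈ (if md (B ℕ.* toℕ (residue (wt B is))) ℕ.≡ᵇ toℕ j then prodL (L.map (ix x) is) else 0#)
    single is = trans (∑-single _ (residue (wt B is)) others)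
      (reflexive (≡.cong (λ z → if md (B ℕ.* toℕ (residue (wt B is))) ℕ.≡ᵇ toℕ j then z else 0#)
                         (≡.cong (if_then prodL (L.map (ix x) is) else 0#) (≡ᵇ-true (≡.sym (get (toℕ-residue-≡ₗ (wt B is))))))))
      where
      others : ∀ r → r ≢ residue (wt B is) → term r is ≈ 0#
      others r r≢ with md (wt B is) ℕ.≡ᵇ md (toℕ r) in eq
      ... | true  = ⊥-elim (r≢ (≡.sym (≡ₗ⇒residue≡ (mk {wt B is} {toℕ r} (≡ᵇ-true⁻¹ {md (wt B is)} {md (toℕ r)} eq)))))
      ... | false = reflexive (if-eta (md (B ℕ.* toℕ r) ℕ.≡ᵇ toℕ j))

  -- the condition i + B·w ≡ t (mod l) on the first index i, rewritten as B·w ≡ t − i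
  ≡ᵇ-shift : ∀ B w t i → (md (B ℕ.* toℕ (residue w)) ℕ.≡ᵇ toℕ (residue (t ℕ.+ n ℕ.* i))) ≡ (md (i ℕ.+ B ℕ.* w) ℕ.≡ᵇ md t)
  ≡ᵇ-shift B w t i = ≡.trans (≡.cong (md (B ℕ.* toℕ (residue w)) ℕ.≡ᵇ_) (toℕ-residue (t ℕ.+ n ℕ.* i))) (≡ᵇ-cong-⇔ to from)
    where
    i+[t-i]≡t : ∀ i t N → i ℕ.+ (t ℕ.+ N ℕ.* i) ≡ t ℕ.+ i ℕ.* suc N
    i+[t-i]≡t = solve-∀
    w+i*l≡i+w+N*i : ∀ i w N → w ℕ.+ i ℕ.* suc N ≡ (i ℕ.+ w) ℕ.+ N ℕ.* i
    w+i*l≡i+w+N*i = solve-∀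
    to : md (B ℕ.* toℕ (residue w)) ≡ md (t ℕ.+ n ℕ.* i) → md (i ℕ.+ B ℕ.* w) ≡ md t
    to p = get (≡ₗ-trans (+-congˡ-≡ₗ i (*-congˡ-≡ₗ B (≡ₗ-sym (toℕ-residue-≡ₗ w))))
                 (≡ₗ-trans (+-congˡ-≡ₗ i (mk {B ℕ.* toℕ (residue w)} {t ℕ.+ n ℕ.* i} p))
                 (≡ₗ-trans (≡⇒≡ₗ (i+[t-i]≡t i t n)) (m+k*l≡ₗm t i))))
    from : md (i ℕ.+ B ℕ.* w) ≡ md t → md (B ℕ.* toℕ (residue w)) ≡ md (t ℕ.+ n ℕ.* i)
    from p = get (≡ₗ-trans (*-congˡ-≡ₗ B (toℕ-residue-≡ₗ w)) (≡ₗ-trans (≡ₗ-sym (m+k*l≡ₗm (B ℕ.* w) i))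
                 (≡ₗ-trans (≡⇒≡ₗ (w+i*l≡i+w+N*i i (B ℕ.* w) n)) (+-cong-≡ₗ (mk {i ℕ.+ B ℕ.* w} {t} p) (≡ₗ-refl {n ℕ.* i})))))

  Tᴳ-suc : ∀ k B x → Tᴳ (suc k) B x ≈G emb x ⋆ σ̂ B (Tᴳ k B x)
  Tᴳ-suc k B x j = begin
    Tₖ (suc k) B (toℕ j) x
      ≈⟨ sumL-concatMap term (λ i → L.map (i ∷_) (tuples k)) (L.upTo l) ⟩
    sumL (L.map (λ i → sumL (L.map term (L.map (i ∷_) (tuples k)))) (L.upTo l))
      ≡⟨ ≡.cong sumL (map-applyUpTo (λ i → i) (λ i → sumL (L.map term (L.map (i ∷_) (tuples k)))) l) ⟩
    sumL (L.applyUpTo (λ i → sumL (L.map term (L.map (i ∷_) (tuples k)))) l)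
      ≡⟨ foldr-applyUpTo l (λ i → sumL (L.map term (L.map (i ∷_) (tuples k)))) ⟩
    ∑ (λ i → sumL (L.map term (L.map (toℕ i ∷_) (tuples k))))
      ≈⟨ ∑-cong first-index ⟩
    (emb x ⋆ σ̂ B (Tᴳ k B x)) j
      ∎
    where
    term : List ℕ → Carrier
    term is = if md (wt B is) ℕ.≡ᵇ md (toℕ j) then prodL (L.map (ix x) is) else 0#
    inner : Fin l → List ℕ → Carrier
    inner i is = if md (B ℕ.* toℕ (residue (wt B is))) ℕ.≡ᵇ toℕ (residue (j ⊖ i)) then prodL (L.map (ix x) is) else 0#
    term-∷ : ∀ i is → term (toℕ i ∷ is) ≈ emb x i * inner i is
    term-∷ i is = begin
      term (toℕ i ∷ is)
        ≡⟨ ≡.cong (if_then ix x (toℕ i) * prodL (L.map (ix x) is) else 0#) (≡ᵇ-shift B (wt B is) (toℕ j) (toℕ i)) ⟨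
      (if md (B ℕ.* toℕ (residue (wt B is))) ℕ.≡ᵇ toℕ (residue (j ⊖ i)) then ix x (toℕ i) * prodL (L.map (ix x) is) else 0#)
        ≡⟨ ≡.cong (λ z → if md (B ℕ.* toℕ (residue (wt B is))) ℕ.≡ᵇ toℕ (residue (j ⊖ i)) then z * prodL (L.map (ix x) is) else 0#)
                  (≡.trans (ix≡at-emb x (toℕ i)) (at-toℕ (emb x) i)) ⟩
      (if md (B ℕ.* toℕ (residue (wt B is))) ℕ.≡ᵇ toℕ (residue (j ⊖ i)) then emb x i * prodL (L.map (ix x) is) else 0#)
        ≈⟨ if-zero (md (B ℕ.* toℕ (residue (wt B is))) ℕ.≡ᵇ toℕ (residue (j ⊖ i))) ⟩
      (if md (B ℕ.* toℕ (residue (wt B is))) ℕ.≡ᵇ toℕ (residue (j ⊖ i)) then emb x i * prodL (L.map (ix x) is) else emb x i * 0#)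
        ≡⟨ if-float (emb x i *_) (md (B ℕ.* toℕ (residue (wt B is))) ℕ.≡ᵇ toℕ (residue (j ⊖ i))) ⟨
      emb x i * inner i is
        ∎
      where
      if-zero : ∀ b → (if b then emb x i * prodL (L.map (ix x) is) else 0#) ≈ (if b then emb x i * prodL (L.map (ix x) is) else emb x i * 0#)
      if-zero true  = refl
      if-zero false = sym (zeroʳ (emb x i))
    first-index : ∀ i → sumL (L.map term (L.map (toℕ i ∷_) (tuples k))) ≈ emb x i * at (σ̂ B (Tᴳ k B x)) (j ⊖ i)
    first-index i = begin
      sumL (L.map term (L.map (toℕ i ∷_) (tuples k)))      ≡⟨ ≡.cong sumL (map-∘ (tuples k)) ⟨
      sumL (L.map (λ is → term (toℕ i ∷ is)) (tuples k))   ≈⟨ sumL-cong (tuples k) (term-∷ i) ⟩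
      sumL (L.map (λ is → emb x i * inner i is) (tuples k)) ≈⟨ sumL-*ˡ (emb x i) (inner i) (tuples k) ⟨
      emb x i * sumL (L.map (inner i) (tuples k))           ≈⟨ *-congˡ (σ̂-Tᴳ k B x (residue (j ⊖ i))) ⟨
      emb x i * at (σ̂ B (Tᴳ k B x)) (j ⊖ i)                ∎

  Tᴳ≈orbitProd : ∀ k B x → Tᴳ k B x ≈G orbitProd B k (emb x)
  Tᴳ≈orbitProd zero    B x = Tᴳ-zero B x
  Tᴳ≈orbitProd (suc k) B x = ≈G-trans (Tᴳ-suc k B x) (⋆-cong (≈G-refl {emb x}) (σ̂-cong B (Tᴳ≈orbitProd k B x)))

  T≈at-orbitProd : ∀ B t x → T B t x ≈ at (orbitProd B f (emb x)) t
  T≈at-orbitProd B t x = trans (reflexive (Tₖ-cong-≡ₗ f B x (≡ₗ-sym (toℕ-residue-≡ₗ t)))) (Tᴳ≈orbitProd f B x (residue t))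

  sgn-+ : ∀ a b → sgn (a ℕ.+ b) ≈ sgn a * sgn b
  sgn-+ zero    b = sym (*-identityˡ _)
  sgn-+ (suc a) b = trans (-‿cong (sgn-+ a b)) (-‿distribˡ-* (sgn a) (sgn b))

  sgn-even : ∀ a → sgn (a ℕ.+ a) ≈ 1#
  sgn-even zero    = refl
  sgn-even (suc a) = trans (reflexive (≡.cong (λ m → - sgn m) (ℕₚ.+-suc a a))) (trans (⁻¹-involutive _) (sgn-even a))

  sgn-^ : ∀ m k → sgn m ^ k ≈ sgn (m ℕ.* k)
  sgn-^ m zero    = reflexive (≡.cong sgn (≡.sym (ℕₚ.*-zeroʳ m)))
  sgn-^ m (suc k) = trans (*-congˡ (sgn-^ m k)) (trans (sym (sgn-+ m (m ℕ.* k))) (reflexive (≡.cong sgn (≡.sym (ℕₚ.*-suc m k)))))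

  sgn[k∸1]^k≈1 : ∀ k → sgn (k ∸ 1) ^ k ≈ 1#
  sgn[k∸1]^k≈1 zero    = refl
  sgn[k∸1]^k≈1 (suc m) = trans (sgn-^ m (suc m)) (sgn[m*[1+m]]≈1 m)
    where
    m*[1+m]-step : ∀ m → suc m ℕ.* suc (suc m) ≡ m ℕ.* suc m ℕ.+ (suc m ℕ.+ suc m)
    m*[1+m]-step = solve-∀
    sgn[m*[1+m]]≈1 : ∀ m → sgn (m ℕ.* suc m) ≈ 1#
    sgn[m*[1+m]]≈1 zero    = refl
    sgn[m*[1+m]]≈1 (suc m) = trans (reflexive (≡.cong sgn (m*[1+m]-step m)))
      (trans (sgn-+ (m ℕ.* suc m) (suc m ℕ.+ suc m)) (trans (*-cong (sgn[m*[1+m]]≈1 m) (sgn-even (suc m))) (*-identityˡ 1#)))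

  sign : Carrier
  sign = sgn (f ∸ 1)

  α≈π : ∀ x → α x ≈P π (sign ⊙ emb x)
  α≈π x k = sym (trans (+-congˡ (-‿cong (zeroʳ sign))) (x-0≈x _))

  op≈π : ∀ x y → op x y ≈P π (sign ⊙ (emb x ⋆ emb y))
  op≈π x y k = trans (*-congˡ (mulL≈π⋆ x y k)) (sym (π-⊙ sign (emb x ⋆ emb y) k))

  emb-op∼ : ∀ x y → emb (op x y) ∼ sign ⊙ (emb x ⋆ emb y)
  emb-op∼ x y = ∼-trans (≈G⇒∼ (emb-cong (op≈π x y))) (emb∘π∼id _)

  α-op≈π : ∀ x y → α (op x y) ≈P π ((sign ⊙ emb x) ⋆ (sign ⊙ emb y))
  α-op≈π x y k = begin
    sign * (sign * mulL x y k)                        ≈⟨ *-congˡ (op≈π x y k) ⟩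
    sign * π (sign ⊙ (emb x ⋆ emb y)) k               ≈⟨ π-⊙ sign (sign ⊙ (emb x ⋆ emb y)) k ⟨
    π (sign ⊙ (sign ⊙ (emb x ⋆ emb y))) k             ≈⟨ π-cong (≈G-sym (≈G-trans (⋆-⊙ˡ sign (emb x) (sign ⊙ emb y)) (⊙-cong refl (⋆-⊙ʳ (emb x) sign (emb y))))) k ⟩
    π ((sign ⊙ emb x) ⋆ (sign ⊙ emb y)) k             ∎

  NonzeroL-cong : ∀ {u v} → u ≈P v → NonzeroL u → NonzeroL v
  NonzeroL-cong u≈v u≢0 v≈0 = u≢0 (λ k → trans (u≈v k) (v≈0 k))

  no-zero-divisors : ∀ x y → ¬ (x ≈ 0#) → ¬ (y ≈ 0#) → ¬ (x * y ≈ 0#)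
  no-zero-divisors x y x≢0 y≢0 xy≈0 with inverse x x≢0
  ... | x⁻¹ , xx⁻¹≈1 = y≢0 (begin
    y                ≈⟨ *-identityˡ y ⟨
    1# * y           ≈⟨ *-congʳ (trans (*-comm x⁻¹ x) xx⁻¹≈1) ⟨
    (x⁻¹ * x) * y    ≈⟨ *-assoc x⁻¹ x y ⟩
    x⁻¹ * (x * y)    ≈⟨ *-congˡ xy≈0 ⟩
    x⁻¹ * 0#         ≈⟨ zeroʳ x⁻¹ ⟩
    0#               ∎)

  isGenerator⇒isPrimitiveRoot : Prime l → ∀ γ → IsGenerator γ → IsPrimitiveRoot γ
  isGenerator⇒isPrimitiveRoot l-prime γ (γ≢0 , order) =
    γ≢0 ∘ get , λ k 1≤k k<n γ^k≡1 → order k 1≤k k<n (≡.trans (get γ^k≡1) (m<n⇒m%n≡m (ℕ.s≤s (PrimeResidues.1≤N n l-prime))))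

  module WithPrimitiveRoot (l-prime : Prime l) (γ : ℕ) (root : IsPrimitiveRoot γ) where
    open PrimeResidues n l-prime
    open PrimitiveRoot γ root
    open Norm l-prime

    1≤e : 1 ≤ e
    1≤e = ℕ.>-nonZero⁻¹ e ⦃ ℕₚ.m*n≢0⇒m≢0 e ⦃ ℕ.>-nonZero 1≤N ⦄ ⦄

    β-unit : Unit (β γ)
    β-unit = unit-^ γ (nonzero⇒unit γ (proj₁ root)) e

    P : Pt → G
    P x = orbitProd (β γ) f (emb x)

    P-invariant : ∀ x → σ̂ (β γ) (P x) ≈G P x
    P-invariant x = orbitProd-invariant (β γ) β-unit f (≡ₗ-trans (≡⇒≡ₗ (ℕₚ.^-*-assoc γ e f)) fermat) (emb x)

    InV⇒P∼h⊙δ₀ : ∀ x → InV γ x → P x ∼ h γ x ⊙ δ₀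
    InV⇒P∼h⊙δ₀ x x∈V = ∼-⊙ P₀-Pγ≈h (constant⇒∼⊙δ₀ (P x) (at (P x) γ) constant)
      where
      constant : ∀ k → P x (Fin.suc k) ≈ at (P x) γ
      constant k = trans (reflexive (≡.sym (at-toℕ (P x) (Fin.suc k))))
        (constant-on-nonzero setoid e 1≤e (at (P x))
           (reflexive ∘ at-cong-≡ₗ (P x))
           (σ̂-invariant⇒at-≈ (β γ) β-unit (P x) (P-invariant x))
           (λ m 1≤m m≤e-1 → trans (sym (T≈at-orbitProd (β γ) (γ ℕ.^ m) x)) (trans (x∈V m 1≤m m≤e-1) (T≈at-orbitProd (β γ) (γ ℕ.^ suc m) x)))
           (suc (toℕ k)) (suc≢ₗ0 k))
      P₀-Pγ≈h : P x Fin.zero - at (P x) γ ≈ h γ x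
      P₀-Pγ≈h = sym (+-cong (T≈at-orbitProd (β γ) 0 x) (-‿cong (T≈at-orbitProd (β γ) γ x)))

    P∼⊙δ₀⇒InV : ∀ z a → P z ∼ a ⊙ δ₀ → InV γ z × h γ z ≈ a
    P∼⊙δ₀⇒InV z a P∼ = z∈V , hz≈a
      where
      d : Carrier
      d = proj₁ P∼
      T-nonzero : ∀ t → ¬ (t ≡ₗ 0) → T (β γ) t z ≈ d
      T-nonzero t t≢0 = trans (T≈at-orbitProd (β γ) t z) (∼⊙δ₀-at-nonzero P∼ t t≢0)
      z∈V : InV γ z
      z∈V m _ _ = trans (T-nonzero (γ ℕ.^ m) (γ^≢ₗ0 m)) (sym (T-nonzero (γ ℕ.^ suc m) (γ^≢ₗ0 (suc m))))
      hz≈a : h γ z ≈ a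
      hz≈a = trans (+-cong (trans (T≈at-orbitProd (β γ) 0 z) (∼⊙δ₀-at-zero P∼)) (-‿cong (T-nonzero γ (proj₁ root))))
                   ([x+y]-y≈x a d)

    P-op∼ : ∀ x y → P (op x y) ∼ P x ⋆ P y
    P-op∼ x y = ∼-trans (orbitProd-∼ (β γ) β-unit f (emb-op∼ x y)) (≈G⇒∼ (
      ≈G-trans (orbitProd-⊙ (β γ) β-unit f sign (emb x ⋆ emb y))
      (≈G-trans (⊙-cong (sgn[k∸1]^k≈1 f) (orbitProd-⋆ (β γ) β-unit f (emb x) (emb y)))
                (λ j → *-identityˡ _))))

    normL≈π∘norm : ∀ u w → u ≈P π w → normL u ≈P π (norm w)
    normL≈π∘norm u w u≈πw k = trans
      (reflexive (≡.cong (λ v → L.foldr mulL oneL v k) (map-tabulate {n = n} (λ a → a) (λ a → σ (suc (toℕ a)) u))))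
      (foldr-mulL≈π∏ (λ a → σ (suc (toℕ a)) u) (λ a → σ̂ (suc (toℕ a)) w)
                     (λ a k′ → trans (σ-cong (suc (toℕ a)) u≈πw k′) (σ-π (suc (toℕ a)) (unit⁺ a) w k′)) k)

    ∼⊙δ₀⇒NonzeroL⇒≉0 : ∀ {A x} → A ∼ x ⊙ δ₀ → NonzeroL (π A) → ¬ (x ≈ 0#)
    ∼⊙δ₀⇒NonzeroL⇒≉0 A∼ πA≢0 x≈0 = πA≢0 (λ k → trans (π-∼⊙δ₀ A∼ k) (trans (-‿cong x≈0) ε⁻¹≈ε))

    ∼⊙δ₀⇒≉0⇒NonzeroL : ∀ {A x} → A ∼ x ⊙ δ₀ → ¬ (x ≈ 0#) → NonzeroL (π A)
    ∼⊙δ₀⇒≉0⇒NonzeroL {x = x} A∼ x≢0 πA≈0 = x≢0 (begin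
      x       ≈⟨ ⁻¹-involutive x ⟨
      - (- x) ≈⟨ -‿cong (trans (sym (π-∼⊙δ₀ A∼ k₀)) (πA≈0 k₀)) ⟩
      - 0#    ≈⟨ ε⁻¹≈ε ⟩
      0#      ∎)
      where
      k₀ : Fin n
      k₀ = fromℕ< 1≤N

    normL-α-op-nonzero : ∀ x y → NonzeroL (normL (α x)) → NonzeroL (normL (α y)) → NonzeroL (normL (α (op x y)))
    normL-α-op-nonzero x y Nαx≢0 Nαy≢0 =
      NonzeroL-cong (λ k → sym (trans (normL≈π∘norm _ _ (α-op≈π x y) k) (π-cong (norm-⋆ (ᾱ x) (ᾱ y)) k)))
        (∼⊙δ₀⇒≉0⇒NonzeroL
          (∼-trans (∼-⋆ (norm-decomposed (ᾱ x)) (norm-decomposed (ᾱ y))) (≈G⇒∼ (⊙δ₀-⋆-⊙δ₀ _ _)))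
          (no-zero-divisors _ _ (normCoeff-nonzero x Nαx≢0) (normCoeff-nonzero y Nαy≢0)))
      where
      ᾱ : Pt → G
      ᾱ x = sign ⊙ emb x
      normCoeff-nonzero : ∀ x → NonzeroL (normL (α x)) → ¬ (normCoeff (ᾱ x) ≈ 0#)
      normCoeff-nonzero x Nαx≢0 =
        ∼⊙δ₀⇒NonzeroL⇒≉0 (norm-decomposed (ᾱ x)) (NonzeroL-cong (normL≈π∘norm _ _ (α≈π x)) Nαx≢0)

corollary1p8 : ∀ {c ℓ : Level} (K : Field c ℓ) (e f : ℕ) →
    let open Field K
        open Cyclotomic K e f
    in 2 ≤ f → Prime l → l ≢ 2 →
       ¬ (ι (f !) ≈ 0#) → ¬ (ι l ≈ 0#) →
       CyclotomicIrreducible →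
       (γ : ℕ) → IsGenerator γ →
       (p q : Carrier) → ¬ (p ≈ 0#) → ¬ (q ≈ 0#) →
       (x y : Pt) → InWp γ p x → InWp γ q y →
       InWp γ (p * q) (op x y)
corollary1p8 K e f _ l-prime _ _ _ _ γ generator p q _ _ x y ((x∈V , Nαx≢0) , hx≈p) ((y∈V , Nαy≢0) , hy≈q) =
  (proj₁ z∈V×hz≈hxhy , normL-α-op-nonzero x y Nαx≢0 Nαy≢0) , trans (proj₂ z∈V×hz≈hxhy) (*-cong hx≈p hy≈q)
  where
  open Field K
  open Cyclotomic K e f using (h; op; InV)
  open Coordinates K e f
  open GroupAlgebra commutativeRing (e ℕ.* f) using (_∼_; ∼-trans; ∼-⋆; ≈G⇒∼; ⊙δ₀-⋆-⊙δ₀; _⊙_; δ₀)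
  open WithPrimitiveRoot l-prime γ (isGenerator⇒isPrimitiveRoot l-prime γ generator)
  Pz∼hxhy⊙δ₀ : P (op x y) ∼ (h γ x * h γ y) ⊙ δ₀
  Pz∼hxhy⊙δ₀ = ∼-trans (P-op∼ x y) (∼-trans (∼-⋆ (InV⇒P∼h⊙δ₀ x x∈V) (InV⇒P∼h⊙δ₀ y y∈V)) (≈G⇒∼ (⊙δ₀-⋆-⊙δ₀ _ _)))
  z∈V×hz≈hxhy : InV γ (op x y) × h γ (op x y) ≈ h γ x * h γ y
  z∈V×hz≈hxhy = P∼⊙δ₀⇒InV (op x y) (h γ x * h γ y) Pz∼hxhy⊙δ₀
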